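{- If $t\to_v^{(m,e)} p$ with $p\in\mathsf{no}_v$, then there exist a context $\Gamma$, a type $\sigma$ and a tight derivation in system $\mathcal{V}$ of $\Gamma\vdash^{(m,e,|p|_v)} t:\sigma$.
   Context: Terms. Fix a countably infinite set of variables. Terms are $t,u,r ::= x \mid \lambda x.t \mid t\,u \mid t[x\backslash u]$, where $t[x\backslash u]$ (explicit substitution) binds $x$ in $t$; terms are taken modulo $\alpha$-conversion and $t\{x:=u\}$ is capture-avoiding meta-level substitution. Values are $v ::= x \mid \lambda x.t$. List contexts are $L ::= \square \mid L[x\backslash t]$; $L\langle t\rangle$ plugs $t$ into the hole. CBV normal forms: $\mathsf{vr}_v ::= x \mid \mathsf{vr}_v[x\backslash \mathsf{ne}_v]$; $\mathsf{ne}_v ::= \mathsf{vr}_v\,\mathsf{no}_v \mid \mathsf{ne}_v\,\mathsf{no}_v \mid \mathsf{ne}_v[x\backslash\mathsf{ne}_v]$; $\mathsf{no}_v ::= \lambda x.t \mid \mathsf{vr}_v \mid \mathsf{ne}_v \mid \mathsf{no}_v[x\backslash\mathsf{ne}_v]$. The $v$-size is $|x|_v = 0$, $|\lambda x.t|_v=0$, $|t\,u|_v = |t|_v+|u|_v+1$, $|t[x\backslash u]|_v = |t|_v+|u|_v$. Reduction. Rule $\mathtt{dB}$: $(L\langle\lambda x.t\rangle)\,u\mapsto L\langle t[x\backslash u]\rangle$; rule $\mathtt{sv}$: $t[x\backslash L\langle v\rangle]\mapsto L\langle t\{x:=v\}\rangle$ for a value $v$. CBV contexts are $V ::= \square \mid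 V\,t \mid t\,V \mid V[x\backslash u] \mid t[x\backslash V]$, and $\to_v$ is the closure of $\mathtt{dB}\cup\mathtt{sv}$ under CBV contexts. $\mathtt{dB}$-steps are multiplicative ($m$-steps), $\mathtt{sv}$-steps exponential ($e$-steps); $t\to_v^{(m,e)}p$ means $t$ reduces to $p$ in finitely many $\to_v$ steps, exactly $m$ of them $m$-steps and $e$ of them $e$-steps. Types. Tight types: $\mathtt{tt} ::= \mathtt{n} \mid \mathtt{vl} \mid \mathtt{vr}$. Types $\sigma,\tau ::= \mathtt{tt}\mid\mathcal{M}\mid\mathcal{M}\to\sigma$, with multitypes $\mathcal{M}=[\sigma_i]_{i\in I}$ finite multisets of types ($[\,]$ empty, $\sqcup$ union). Typing contexts $\Gamma$ map variables to multitypes, $[\,]$ for all but finitely many; $(\Gamma+\Delta)(x)=\Gamma(x)\sqcup\Delta(x)$, extended to finite sums; $\Gamma\setminus\!\!\setminus x$ maps $x$ to $[\,]$ and agrees with $\Gamma$ elsewhere. Judgements $\Gamma\vdash^{(m,e,s)} t:\sigma$ carry integer counters. System $\mathcal{V}$ has the rules: (var$_p$) $x:[\mathtt{vr}]\vdash^{(0,0,0)} x:\mathtt{vr}$; (val$_p$) $\emptyset\vdash^{(0,0,0)} x:\mathtt{vl}$; (abs$_p$) $\emptyset\vdash^{(0,0,0)}\lambda x.t:\mathtt{vl}$; (app$_p$) from $\Gamma\vdash^{(m,e,s)} t:\mathtt{tt}_1$ with $\mathtt{tt}_1\in\{\mathtt{vr},\mathtt{n}\}$ and $\Delta\vdash^{(m',e',s')}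 u:\mathtt{tt}_2$ with $\mathtt{tt}_2\in\{\mathtt{vl},\mathtt{n}\}$, infer $\Gamma+\Delta\vdash^{(m+m',e+e',s+s'+1)} t\,u:\mathtt{n}$; (es$_p$) from $\Gamma\vdash^{(m,e,s)} t:\tau$, $\Delta\vdash^{(m',e',s')} u:\mathtt{n}$ and $\Gamma(x)$ tight, infer $(\Gamma\setminus\!\!\setminus x)+\Delta\vdash^{(m+m',e+e',s+s')} t[x\backslash u]:\tau$; (var$_c$) $x:\mathcal{M}\vdash^{(0,1,0)} x:\mathcal{M}$ for any multitype $\mathcal{M}$; (app$_c$) from $\Gamma\vdash^{(m,e,s)} t:[\mathcal{M}\to\tau]$ and $\Delta\vdash^{(m',e',s')} u:\mathcal{M}$, infer $\Gamma+\Delta\vdash^{(m+m'+1,e+e'-1,s+s')} t\,u:\tau$; (appt$_c$) from $\Gamma\vdash^{(m,e,s)} t:[\mathcal{M}\to\tau]$, $\Delta\vdash^{(m',e',s')} u:\mathtt{n}$ and $\mathcal{M}$ tight, infer $\Gamma+\Delta\vdash^{(m+m'+1,e+e'-1,s+s')} t\,u:\tau$; (abs$_c$) from $\Gamma_i\vdash^{(m_i,e_i,s_i)} t:\tau_i$ for each $i\in I$ ($I$ finite, possibly empty), infer $+_{i\in I}(\Gamma_i\setminus\!\!\setminus x)\vdash^{(\sum_i m_i,\,1+\sum_i e_i,\,\sum_i s_i)}\lambda x.t:[\Gamma_i(x)\to\tau_i]_{i\in I}$; (es$_c$) from $\Gamma\vdash^{(m,e,s)} t:\sigma$ and $\Delta\vdash^{(m',e',s')}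 u:\Gamma(x)$, infer $(\Gamma\setminus\!\!\setminus x)+\Delta\vdash^{(m+m',e+e',s+s')} t[x\backslash u]:\sigma$. A multitype is tight if all its elements are tight types; a context is tight if all its multitypes are tight; a derivation of $\Gamma\vdash^{(m,e,s)} t:\sigma$ is tight if $\Gamma$ is tight and $\sigma$ is a tight type. -}

module Defs where

open import Data.Nat using (ℕ; zero; suc; _+_; _≤_; _≟_)
open import Data.Integer as ℤ using (ℤ; +_) renaming (_+_ to _+ℤ_; _-_ to _-ℤ_)
open import Data.List using (List; []; _∷_; _++_; [_])
open import Data.List.Relation.Unary.All using (All)
open import Data.Product using (Σ; ∃; ∃-syntax; _×_; _,_)
open import Relation.Binary.PropositionalEquality using (_≡_)
open import Relation.Nullary using (yes; no)

-- Terms (locally nameless / de Bruijn: terms modulo α-conversion)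
-- ` n   : variable with de Bruijn index n
-- ƛ t   : λ-abstraction, binds index 0 in t
-- t · u : application
-- t ⦅ u ⦆ : explicit substitution t[x\u], binds index 0 in t

infixl 7 _·_
infixl 8 _⦅_⦆

data Term : Set where
  `_   : ℕ → Term
  ƛ_   : Term → Term
  _·_  : Term → Term → Term
  _⦅_⦆ : Term → Term → Term

ext : (ℕ → ℕ) → ℕ → ℕ
ext ρ zero    = zero
ext ρ (suc n) = suc (ρ n)

ren : (ℕ → ℕ) → Term → Term
ren ρ (` n)     = ` (ρ n)
ren ρ (ƛ t)     = ƛ ren (ext ρ) t
ren ρ (t · u)   = ren ρ t · ren ρ u
ren ρ (t ⦅ u ⦆) = ren (ext ρ) t ⦅ ren ρ u ⦆

exts : (ℕ → Term) → ℕ → Term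
exts σ zero    = ` zero
exts σ (suc n) = ren suc (σ n)

sub : (ℕ → Term) → Term → Term
sub σ (` n)     = σ n
sub σ (ƛ t)     = ƛ sub (exts σ) t
sub σ (t · u)   = sub σ t · sub σ u
sub σ (t ⦅ u ⦆) = sub (exts σ) t ⦅ sub σ u ⦆

data Value : Term → Set where
  v-var : ∀ {n} → Value (` n)
  v-lam : ∀ {t} → Value (ƛ t)

data LCtx : Set where
  □     : LCtx
  _⟦_⟧ : LCtx → Term → LCtx

depth : LCtx → ℕ
depth □         = 0
depth (L ⟦ t ⟧) = suc (depth L)

-- L⟨s⟩ ; s lives in the scope extended by the depth L variables bound by L
plug : LCtx → Term → Term
plug □         s = s
plug (L ⟦ t ⟧) s = plug L s ⦅ t ⦆

-- the substitution used by rule sv: index 0 ↦ v, index (suc i) ↦ i shifted past L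
svSub : ℕ → Term → ℕ → Term
svSub k v zero    = v
svSub k v (suc i) = ` (k + i)

data Kind : Set where
  mul expo : Kind

infix 4 _↦[_]_ _→v[_]_ _→v⟨_,_⟩_
data _↦[_]_ : Term → Kind → Term → Set where
  dB : ∀ L t u →
       (plug L (ƛ t)) · u ↦[ mul ] plug L (t ⦅ ren (λ i → depth L + i) u ⦆)
  sv : ∀ L t v → Value v →
       t ⦅ plug L v ⦆ ↦[ expo ] plug L (sub (svSub (depth L) v) t)

data _→v[_]_ : Term → Kind → Term → Set where
  root : ∀ {t u k} → t ↦[ k ] u → t →v[ k ] u
  appL : ∀ {t t' u k} → t →v[ k ] t' → (t · u) →v[ k ] (t' · u)
  appR : ∀ {t u u' k} → u →v[ k ] u' → (t · u) →v[ k ] (t · u')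
  esL  : ∀ {t t' u k} → t →v[ k ] t' → (t ⦅ u ⦆) →v[ k ] (t' ⦅ u ⦆)
  esR  : ∀ {t u u' k} → u →v[ k ] u' → (t ⦅ u ⦆) →v[ k ] (t ⦅ u' ⦆)

data _→v⟨_,_⟩_ : Term → ℕ → ℕ → Term → Set where
  done  : ∀ {t} → t →v⟨ 0 , 0 ⟩ t
  stepm : ∀ {t t' p m e} → t →v[ mul ] t' → t' →v⟨ m , e ⟩ p → t →v⟨ suc m , e ⟩ p
  stepe : ∀ {t t' p m e} → t →v[ expo ] t' → t' →v⟨ m , e ⟩ p → t →v⟨ m , suc e ⟩ p

mutual
  data Vr : Term → Set where
    vr-var : ∀ {n} → Vr (` n)
    vr-es  : ∀ {t u} → Vr t → Ne u → Vr (t ⦅ u ⦆)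

  data Ne : Term → Set where
    ne-vr  : ∀ {t u} → Vr t → No u → Ne (t · u)
    ne-ne  : ∀ {t u} → Ne t → No u → Ne (t · u)
    ne-es  : ∀ {t u} → Ne t → Ne u → Ne (t ⦅ u ⦆)

  data No : Term → Set where
    no-lam : ∀ {t} → No (ƛ t)
    no-vr  : ∀ {t} → Vr t → No t
    no-ne  : ∀ {t} → Ne t → No t
    no-es  : ∀ {t u} → No t → Ne u → No (t ⦅ u ⦆)

size : Term → ℕ
size (` n)     = 0
size (ƛ t)     = 0
size (t · u)   = size t + size u + 1
size (t ⦅ u ⦆) = size t + size u

-- Types.  Multitypes are finite multisets, represented by lists taken
-- up to the (nested) multiset equivalence _≈M_ below.

data TT : Set where
  n vl vr : TT

data Ty : Set where
  tt   : TT → Ty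
  mult : List Ty → Ty
  _⇒_  : List Ty → Ty → Ty

MType : Set
MType = List Ty

mutual
  data _≈T_ : Ty → Ty → Set where
    tt≈   : ∀ {a} → tt a ≈T tt a
    mult≈ : ∀ {M N} → M ≈M N → mult M ≈T mult N
    ⇒≈    : ∀ {M N σ τ} → M ≈M N → σ ≈T τ → (M ⇒ σ) ≈T (N ⇒ τ)

  data _≈M_ : MType → MType → Set where
    []≈ : [] ≈M []
    ∷≈  : ∀ {σ τ M N₁ N₂} → σ ≈T τ → M ≈M (N₁ ++ N₂) → (σ ∷ M) ≈M (N₁ ++ τ ∷ N₂)

IsTight : Ty → Set
IsTight σ = ∃[ a ] (σ ≡ tt a)

TightM : MType → Set
TightM M = All IsTight M

Ctx : Set
Ctx = ℕ → MType

∅ : Ctx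
∅ _ = []

_∶ᶜ_ : ℕ → MType → Ctx
(x ∶ᶜ M) y with x ≟ y
... | yes _ = M
... | no  _ = []

_+ᶜ_ : Ctx → Ctx → Ctx
(Γ +ᶜ Δ) x = Γ x ++ Δ x

-- Γ\\x for the bound variable (index 0), re-indexed to the outer scope
unbind : Ctx → Ctx
unbind Γ x = Γ (suc x)

_≈C_ : Ctx → Ctx → Set
Γ ≈C Δ = ∀ x → Γ x ≈M Δ x

TightCtx : Ctx → Set
TightCtx Γ = ∀ x → TightM (Γ x)

FiniteSupport : Ctx → Set
FiniteSupport Γ = ∃[ N ] (∀ x → N ≤ x → Γ x ≡ [])

data VrN : TT → Set where
  vrN-vr : VrN vr
  vrN-n  : VrN n

data VlN : TT → Set where
  vlN-vl : VlN vl
  vlN-n  : VlN n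

infix 4 _⊢⟨_,_,_⟩_∶_

mutual
  data _⊢⟨_,_,_⟩_∶_ : Ctx → ℤ → ℤ → ℤ → Term → Ty → Set where
    var-p : ∀ {x} → (x ∶ᶜ [ tt vr ]) ⊢⟨ + 0 , + 0 , + 0 ⟩ ` x ∶ tt vr
    val-p : ∀ {x} → ∅ ⊢⟨ + 0 , + 0 , + 0 ⟩ ` x ∶ tt vl
    abs-p : ∀ {t} → ∅ ⊢⟨ + 0 , + 0 , + 0 ⟩ ƛ t ∶ tt vl
    app-p : ∀ {Γ Δ m e s m' e' s' t u a b} →
            Γ ⊢⟨ m , e , s ⟩ t ∶ tt a → VrN a →
            Δ ⊢⟨ m' , e' , s' ⟩ u ∶ tt b → VlN b →
            (Γ +ᶜ Δ) ⊢⟨ m +ℤ m' , e +ℤ e' , s +ℤ s' +ℤ + 1 ⟩ t · u ∶ tt n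
    es-p  : ∀ {Γ Δ m e s m' e' s' t u τ} →
            Γ ⊢⟨ m , e , s ⟩ t ∶ τ →
            Δ ⊢⟨ m' , e' , s' ⟩ u ∶ tt n →
            TightM (Γ 0) →
            (unbind Γ +ᶜ Δ) ⊢⟨ m +ℤ m' , e +ℤ e' , s +ℤ s' ⟩ t ⦅ u ⦆ ∶ τ
    var-c : ∀ {x M} → (x ∶ᶜ M) ⊢⟨ + 0 , + 1 , + 0 ⟩ ` x ∶ mult M
    app-c : ∀ {Γ Δ m e s m' e' s' t u M τ} →
            Γ ⊢⟨ m , e , s ⟩ t ∶ mult [ M ⇒ τ ] →
            Δ ⊢⟨ m' , e' , s' ⟩ u ∶ mult M →
            (Γ +ᶜ Δ) ⊢⟨ m +ℤ m' +ℤ + 1 , e +ℤ e' -ℤ + 1 , s +ℤ s' ⟩ t · u ∶ τ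
    appt-c : ∀ {Γ Δ m e s m' e' s' t u M τ} →
            Γ ⊢⟨ m , e , s ⟩ t ∶ mult [ M ⇒ τ ] →
            Δ ⊢⟨ m' , e' , s' ⟩ u ∶ tt n →
            TightM M →
            (Γ +ᶜ Δ) ⊢⟨ m +ℤ m' +ℤ + 1 , e +ℤ e' -ℤ + 1 , s +ℤ s' ⟩ t · u ∶ τ
    abs-c : ∀ {Γ m e s t Ms} →
            AbsPremises t Γ m e s Ms →
            Γ ⊢⟨ m , + 1 +ℤ e , s ⟩ ƛ t ∶ mult Ms
    es-c  : ∀ {Γ Δ m e s m' e' s' t u σ} →
            Γ ⊢⟨ m , e , s ⟩ t ∶ σ →
            Δ ⊢⟨ m' , e' , s' ⟩ u ∶ mult (Γ 0) →
            (unbind Γ +ᶜ Δ) ⊢⟨ m +ℤ m' , e +ℤ e' , s +ℤ s' ⟩ t ⦅ u ⦆ ∶ σ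
    -- multisets are represented by lists: identify them up to reordering
    conv  : ∀ {Γ Γ' m e s t σ σ'} →
            Γ ⊢⟨ m , e , s ⟩ t ∶ σ → Γ ≈C Γ' → σ ≈T σ' →
            Γ' ⊢⟨ m , e , s ⟩ t ∶ σ'

  -- the finite family of premises Γᵢ ⊢ t : τᵢ (i ∈ I) of rule abs-c, with
  -- accumulated context +ᵢ (Γᵢ\\x), counters Σ mᵢ, Σ eᵢ, Σ sᵢ and
  -- multitype [Γᵢ(x) → τᵢ]ᵢ
  data AbsPremises (t : Term) : Ctx → ℤ → ℤ → ℤ → MType → Set where
    none : AbsPremises t ∅ (+ 0) (+ 0) (+ 0) []
    more : ∀ {Γ Δ m e s m' e' s' τ Ms} →
           Γ ⊢⟨ m , e , s ⟩ t ∶ τ →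
           AbsPremises t Δ m' e' s' Ms →
           AbsPremises t (unbind Γ +ᶜ Δ) (m +ℤ m') (e +ℤ e') (s +ℤ s') ((Γ 0 ⇒ τ) ∷ Ms)

module Submission where

-- A normal form p has a tight derivation with counters (0, 0, |p|_v) built from the
-- persistent rules alone. Going backwards along t →v* p, every step is undone on
-- derivations at the price of exactly one more m (dB) or e (sv): a dB step by retyping
-- t[x\u] as (λx.t) u, an sv step by anti-substitution, which splits a derivation of
-- t{x:=v} into one of t and one of the value v at the multitype of x, assembled from
-- the multitypes v receives at the occurrences of x. The list context around a redex
-- is crossed by strengthening. Multitypes are lists, so all of this holds up to their
-- permutation equivalence, which the rule conv absorbs.

open import Defs
open import Data.Nat as ℕ using (ℕ; zero; suc; _≤_; _<_; s≤s) renaming (_+_ to _+ℕ_)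
import Data.Nat.Properties as ℕP
open import Data.Integer as ℤ using (ℤ; +_) renaming (_+_ to _+ℤ_; _-_ to _-ℤ_)
open import Data.List using (List; []; _∷_; _++_; [_])
open import Data.List.Properties using (++-assoc; ++-identityʳ; ∷-injective)
open import Data.List.Relation.Unary.All using ([]; _∷_)
open import Data.List.Relation.Unary.All.Properties using (++⁺; ++⁻ˡ; ++⁻ʳ)
open import Data.Product using (∃-syntax; _×_; _,_)
open import Data.Sum using (_⊎_; inj₁; inj₂)
open import Data.Empty using (⊥-elim)
open import Function using (_∘_; id)
open import Relation.Nullary using (yes; no)
open import Relation.Binary.Definitions using (tri<; tri≈; tri>)
open import Data.Integer.Tactic.RingSolver using (solve-∀)
import Data.Integer.Properties as ℤP
open import Algebra.Properties.CommutativeSemigroup ℤP.+-commutativeSemigroup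
  using (interchange; xy∙z≈xz∙y)
open import Relation.Binary.PropositionalEquality
  using (_≡_; _≢_; _≗_; refl; sym; trans; cong; cong₂; subst)

mutual
  ≈T-refl : ∀ {σ} → σ ≈T σ
  ≈T-refl {tt a}   = tt≈
  ≈T-refl {mult M} = mult≈ ≈M-refl
  ≈T-refl {M ⇒ σ}  = ⇒≈ ≈M-refl ≈T-refl

  ≈M-refl : ∀ {M} → M ≈M M
  ≈M-refl {[]}    = []≈
  ≈M-refl {σ ∷ M} = ∷≈ {N₁ = []} ≈T-refl ≈M-refl

≡⇒≈M : ∀ {M N} → M ≡ N → M ≈M N
≡⇒≈M refl = ≈M-refl

≈M-∷ : ∀ {σ τ M N} → σ ≈T τ → M ≈M N → (σ ∷ M) ≈M (τ ∷ N)
≈M-∷ = ∷≈ {N₁ = []}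

≈M-++ˡ : ∀ N {M M′} → M ≈M M′ → (N ++ M) ≈M (N ++ M′)
≈M-++ˡ []      p = p
≈M-++ˡ (σ ∷ N) p = ≈M-∷ ≈T-refl (≈M-++ˡ N p)

≈M-++ʳ : ∀ {M M′} N → M ≈M M′ → (M ++ N) ≈M (M′ ++ N)
≈M-++ʳ N []≈ = ≈M-refl
≈M-++ʳ N (∷≈ {σ} {τ} {M} {N₁} {N₂} p q) =
  subst (λ X → ((σ ∷ M) ++ N) ≈M X) (sym (++-assoc N₁ (τ ∷ N₂) N))
    (∷≈ {N₁ = N₁} {N₂ = N₂ ++ N} p
      (subst (λ X → (M ++ N) ≈M X) (++-assoc N₁ N₂ N) (≈M-++ʳ N q)))

≈M-shift : ∀ N₁ {τ} N₂ → (N₁ ++ τ ∷ N₂) ≈M (τ ∷ (N₁ ++ N₂))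
≈M-shift []       N₂ = ≈M-refl
≈M-shift (ν ∷ N₁) N₂ = ∷≈ {N₁ = [ _ ]} ≈T-refl (≈M-shift N₁ N₂)

++-∷-split : ∀ {A : Set} (Q₁ Q₂ R₁ R₂ : List A) {ρ} → Q₁ ++ Q₂ ≡ R₁ ++ ρ ∷ R₂ →
             (∃[ X ] (Q₁ ≡ R₁ ++ ρ ∷ X × R₂ ≡ X ++ Q₂)) ⊎
             (∃[ Y ] (R₁ ≡ Q₁ ++ Y × Q₂ ≡ Y ++ ρ ∷ R₂))
++-∷-split []       Q₂ R₁       R₂ eq   = inj₂ (R₁ , refl , eq)
++-∷-split (x ∷ Q₁) Q₂ []       R₂ refl = inj₁ (Q₁ , refl , refl)
++-∷-split (x ∷ Q₁) Q₂ (y ∷ R₁) R₂ eq with ∷-injective eq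
... | refl , eq′ with ++-∷-split Q₁ Q₂ R₁ R₂ eq′
...   | inj₁ (X , e₁ , e₂) = inj₁ (X , cong (x ∷_) e₁ , e₂)
...   | inj₂ (Y , e₁ , e₂) = inj₂ (Y , cong (x ∷_) e₁ , e₂)

≈M-remove : ∀ N₁ {τ} N₂ {C} → (N₁ ++ τ ∷ N₂) ≈M C →
            ∃[ P₁ ] ∃[ P₂ ] ∃[ ρ ]
              (C ≡ P₁ ++ ρ ∷ P₂ × τ ≈T ρ × (N₁ ++ N₂) ≈M (P₁ ++ P₂))
≈M-remove [] N₂ (∷≈ {N₁ = Q₁} {N₂ = Q₂} p q) = Q₁ , Q₂ , _ , refl , p , q
≈M-remove (ν ∷ N₁) N₂ (∷≈ {τ = κ} {N₁ = Q₁} {N₂ = Q₂} p q) with ≈M-remove N₁ N₂ q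
... | R₁ , R₂ , ρ , eq , τ≈ρ , r with ++-∷-split Q₁ Q₂ R₁ R₂ eq
...   | inj₁ (X , refl , refl) =
  R₁ , X ++ κ ∷ Q₂ , ρ , ++-assoc R₁ (ρ ∷ X) (κ ∷ Q₂) , τ≈ρ ,
  subst (λ Z → (ν ∷ (N₁ ++ N₂)) ≈M Z) (++-assoc R₁ X (κ ∷ Q₂))
    (∷≈ {N₁ = R₁ ++ X} p (subst (λ Z → (N₁ ++ N₂) ≈M Z) (sym (++-assoc R₁ X Q₂)) r))
...   | inj₂ (Y , refl , refl) =
  Q₁ ++ κ ∷ Y , R₂ , ρ , sym (++-assoc Q₁ (κ ∷ Y) (ρ ∷ R₂)) , τ≈ρ ,
  subst (λ Z → (ν ∷ (N₁ ++ N₂)) ≈M Z) (sym (++-assoc Q₁ (κ ∷ Y) R₂))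
    (∷≈ {N₁ = Q₁} p (subst (λ Z → (N₁ ++ N₂) ≈M Z) (++-assoc Q₁ Y R₂) r))

mutual
  ≈T-trans : ∀ {σ τ ρ} → σ ≈T τ → τ ≈T ρ → σ ≈T ρ
  ≈T-trans tt≈        q          = q
  ≈T-trans (mult≈ p)  (mult≈ q)  = mult≈ (≈M-trans p q)
  ≈T-trans (⇒≈ p p′) (⇒≈ q q′) = ⇒≈ (≈M-trans p q) (≈T-trans p′ q′)

  ≈M-trans : ∀ {A B C} → A ≈M B → B ≈M C → A ≈M C
  ≈M-trans []≈ q = q
  ≈M-trans (∷≈ {N₁ = N₁} {N₂ = N₂} p q) r with ≈M-remove N₁ N₂ r
  ... | P₁ , P₂ , ρ , refl , τ≈ρ , r′ = ∷≈ (≈T-trans p τ≈ρ) (≈M-trans q r′)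

mutual
  ≈T-sym : ∀ {σ τ} → σ ≈T τ → τ ≈T σ
  ≈T-sym tt≈       = tt≈
  ≈T-sym (mult≈ p) = mult≈ (≈M-sym p)
  ≈T-sym (⇒≈ p q)  = ⇒≈ (≈M-sym p) (≈T-sym q)

  ≈M-sym : ∀ {A B} → A ≈M B → B ≈M A
  ≈M-sym []≈ = []≈
  ≈M-sym (∷≈ {N₁ = N₁} {N₂ = N₂} p q) =
    ≈M-trans (≈M-shift N₁ N₂) (≈M-∷ (≈T-sym p) (≈M-sym q))

≈M-++ : ∀ {A A′ B B′} → A ≈M A′ → B ≈M B′ → (A ++ B) ≈M (A′ ++ B′)
≈M-++ {A′ = A′} {B} p q = ≈M-trans (≈M-++ʳ B p) (≈M-++ˡ A′ q)

≈M-++-comm : ∀ M N → (M ++ N) ≈M (N ++ M)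
≈M-++-comm []      N = ≡⇒≈M (sym (++-identityʳ N))
≈M-++-comm (σ ∷ M) N = ∷≈ {N₁ = N} ≈T-refl (≈M-++-comm M N)

≈M-[]⁻¹ : ∀ {M} → [] ≈M M → M ≡ []
≈M-[]⁻¹ []≈ = refl

TightM-resp-≈M : ∀ {M N} → M ≈M N → TightM M → TightM N
TightM-resp-≈M []≈ t = t
TightM-resp-≈M (∷≈ {N₁ = N₁} tt≈ q) (tσ ∷ tM) =
  ++⁺ (++⁻ˡ N₁ (TightM-resp-≈M q tM)) (tσ ∷ ++⁻ʳ N₁ (TightM-resp-≈M q tM))

≈C-refl : ∀ {Γ} → Γ ≈C Γ
≈C-refl x = ≈M-refl

≈C-sym : ∀ {Γ Δ} → Γ ≈C Δ → Δ ≈C Γ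
≈C-sym p x = ≈M-sym (p x)

≈C-trans : ∀ {Γ Δ Θ} → Γ ≈C Δ → Δ ≈C Θ → Γ ≈C Θ
≈C-trans p q x = ≈M-trans (p x) (q x)

≗⇒≈C : ∀ {Γ Δ} → Γ ≗ Δ → Γ ≈C Δ
≗⇒≈C p x = ≡⇒≈M (p x)

≗∅⇒≈C : ∀ {Γ Δ} → Γ ≗ ∅ → Δ ≗ ∅ → Γ ≈C Δ
≗∅⇒≈C p q = ≗⇒≈C (λ x → trans (p x) (sym (q x)))

≈C-resp-≗∅ : ∀ {Γ Δ} → Γ ≈C Δ → Δ ≗ ∅ → Γ ≗ ∅
≈C-resp-≗∅ p Δ≗∅ x = ≈M-[]⁻¹ (≈M-sym (subst (_ ≈M_) (Δ≗∅ x) (p x)))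

+ᶜ-cong : ∀ {Γ Γ′ Δ Δ′} → Γ ≈C Γ′ → Δ ≈C Δ′ → (Γ +ᶜ Δ) ≈C (Γ′ +ᶜ Δ′)
+ᶜ-cong p q x = ≈M-++ (p x) (q x)

+ᶜ-congˡ : ∀ Γ {Δ Δ′} → Δ ≈C Δ′ → (Γ +ᶜ Δ) ≈C (Γ +ᶜ Δ′)
+ᶜ-congˡ Γ = +ᶜ-cong (≈C-refl {Γ})

+ᶜ-congʳ : ∀ Δ {Γ Γ′} → Γ ≈C Γ′ → (Γ +ᶜ Δ) ≈C (Γ′ +ᶜ Δ)
+ᶜ-congʳ Δ p = +ᶜ-cong p (≈C-refl {Δ})

unbind-cong : ∀ {Γ Γ′} → Γ ≈C Γ′ → unbind Γ ≈C unbind Γ′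
unbind-cong p x = p (suc x)

+ᶜ-comm : ∀ Γ Δ → (Γ +ᶜ Δ) ≈C (Δ +ᶜ Γ)
+ᶜ-comm Γ Δ x = ≈M-++-comm (Γ x) (Δ x)

+ᶜ-assoc : ∀ Γ Δ Θ → ((Γ +ᶜ Δ) +ᶜ Θ) ≈C (Γ +ᶜ (Δ +ᶜ Θ))
+ᶜ-assoc Γ Δ Θ x = ≡⇒≈M (++-assoc (Γ x) (Δ x) (Θ x))

+ᶜ-identityʳ : ∀ Γ → (Γ +ᶜ ∅) ≈C Γ
+ᶜ-identityʳ Γ x = ≡⇒≈M (++-identityʳ (Γ x))

+ᶜ-swapʳ : ∀ Γ Δ Θ → ((Γ +ᶜ Δ) +ᶜ Θ) ≈C ((Γ +ᶜ Θ) +ᶜ Δ)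
+ᶜ-swapʳ Γ Δ Θ =
  ≈C-trans (+ᶜ-assoc Γ Δ Θ)
    (≈C-trans (+ᶜ-congˡ Γ (+ᶜ-comm Δ Θ)) (≈C-sym (+ᶜ-assoc Γ Θ Δ)))

+ᶜ-interchange : ∀ Γ Δ Θ Ξ → ((Γ +ᶜ Δ) +ᶜ (Θ +ᶜ Ξ)) ≈C ((Γ +ᶜ Θ) +ᶜ (Δ +ᶜ Ξ))
+ᶜ-interchange Γ Δ Θ Ξ =
  ≈C-trans (≈C-sym (+ᶜ-assoc (Γ +ᶜ Δ) Θ Ξ))
    (≈C-trans (+ᶜ-congʳ Ξ (+ᶜ-swapʳ Γ Δ Θ)) (+ᶜ-assoc (Γ +ᶜ Θ) Δ Ξ))

singleᶜ : ℕ → MType → Ctx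
singleᶜ zero    M zero    = M
singleᶜ zero    M (suc x) = []
singleᶜ (suc y) M zero    = []
singleᶜ (suc y) M (suc x) = singleᶜ y M x

singleᶜ-here : ∀ y M → singleᶜ y M y ≡ M
singleᶜ-here zero    M = refl
singleᶜ-here (suc y) M = singleᶜ-here y M

singleᶜ-there : ∀ y M x → y ≢ x → singleᶜ y M x ≡ []
singleᶜ-there zero    M zero    y≢x = ⊥-elim (y≢x refl)
singleᶜ-there zero    M (suc x) y≢x = refl
singleᶜ-there (suc y) M zero    y≢x = refl
singleᶜ-there (suc y) M (suc x) y≢x = singleᶜ-there y M x (λ e → y≢x (cong suc e))

∶ᶜ≗singleᶜ : ∀ y M → (y ∶ᶜ M) ≗ singleᶜ y M
∶ᶜ≗singleᶜ y M x with y ℕ.≟ x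
... | yes refl = sym (singleᶜ-here y M)
... | no  y≢x  = sym (singleᶜ-there y M x y≢x)

singleᶜ-[] : ∀ y → singleᶜ y [] ≗ ∅
singleᶜ-[] zero    zero    = refl
singleᶜ-[] zero    (suc x) = refl
singleᶜ-[] (suc y) zero    = refl
singleᶜ-[] (suc y) (suc x) = singleᶜ-[] y x

singleᶜ-++ : ∀ y M N → singleᶜ y (M ++ N) ≗ (singleᶜ y M +ᶜ singleᶜ y N)
singleᶜ-++ zero    M N zero    = refl
singleᶜ-++ zero    M N (suc x) = refl
singleᶜ-++ (suc y) M N zero    = refl
singleᶜ-++ (suc y) M N (suc x) = singleᶜ-++ y M N x

singleᶜ-cong : ∀ y {M N} → M ≈M N → singleᶜ y M ≈C singleᶜ y N
singleᶜ-cong zero    p zero    = p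
singleᶜ-cong zero    p (suc x) = []≈
singleᶜ-cong (suc y) p zero    = []≈
singleᶜ-cong (suc y) p (suc x) = singleᶜ-cong y p x

punchIn : ℕ → ℕ → ℕ
punchIn zero    = suc
punchIn (suc d) = ext (punchIn d)

insertᶜ : ℕ → Ctx → Ctx
insertᶜ zero    Γ zero    = []
insertᶜ zero    Γ (suc x) = Γ x
insertᶜ (suc d) Γ zero    = Γ zero
insertᶜ (suc d) Γ (suc x) = insertᶜ d (unbind Γ) x

insertᶜ-+ : ∀ d Γ Δ → insertᶜ d (Γ +ᶜ Δ) ≗ (insertᶜ d Γ +ᶜ insertᶜ d Δ)
insertᶜ-+ zero    Γ Δ zero    = refl
insertᶜ-+ zero    Γ Δ (suc x) = refl
insertᶜ-+ (suc d) Γ Δ zero    = refl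
insertᶜ-+ (suc d) Γ Δ (suc x) = insertᶜ-+ d (unbind Γ) (unbind Δ) x

insertᶜ-∅ : ∀ d {Γ} → Γ ≗ ∅ → insertᶜ d Γ ≗ ∅
insertᶜ-∅ zero    Γ≗∅ zero    = refl
insertᶜ-∅ zero    Γ≗∅ (suc x) = Γ≗∅ x
insertᶜ-∅ (suc d) Γ≗∅ zero    = Γ≗∅ zero
insertᶜ-∅ (suc d) Γ≗∅ (suc x) = insertᶜ-∅ d (λ y → Γ≗∅ (suc y)) x

insertᶜ-singleᶜ : ∀ d y M → singleᶜ (punchIn d y) M ≗ insertᶜ d (singleᶜ y M)
insertᶜ-singleᶜ zero    y       M zero    = refl
insertᶜ-singleᶜ zero    y       M (suc x) = refl
insertᶜ-singleᶜ (suc d) zero    M zero    = refl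
insertᶜ-singleᶜ (suc d) zero    M (suc x) = sym (insertᶜ-∅ d (λ _ → refl) x)
insertᶜ-singleᶜ (suc d) (suc y) M zero    = refl
insertᶜ-singleᶜ (suc d) (suc y) M (suc x) = insertᶜ-singleᶜ d y M x

removeᶜ : ℕ → Ctx → Ctx
removeᶜ zero    Γ x       = Γ (suc x)
removeᶜ (suc d) Γ zero    = Γ zero
removeᶜ (suc d) Γ (suc x) = removeᶜ d (unbind Γ) x

removeᶜ-+ : ∀ d Γ Δ → removeᶜ d (Γ +ᶜ Δ) ≗ (removeᶜ d Γ +ᶜ removeᶜ d Δ)
removeᶜ-+ zero    Γ Δ x       = refl
removeᶜ-+ (suc d) Γ Δ zero    = refl
removeᶜ-+ (suc d) Γ Δ (suc x) = removeᶜ-+ d (unbind Γ) (unbind Δ) x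

removeᶜ-∅ : ∀ d {Γ} → Γ ≗ ∅ → removeᶜ d Γ ≗ ∅
removeᶜ-∅ zero    Γ≗∅ x       = Γ≗∅ (suc x)
removeᶜ-∅ (suc d) Γ≗∅ zero    = Γ≗∅ zero
removeᶜ-∅ (suc d) Γ≗∅ (suc x) = removeᶜ-∅ d (λ y → Γ≗∅ (suc y)) x

removeᶜ-singleᶜ-< : ∀ d y M → y < d → removeᶜ d (singleᶜ y M) ≗ singleᶜ y M
removeᶜ-singleᶜ-< (suc d) zero    M y<d       zero    = refl
removeᶜ-singleᶜ-< (suc d) zero    M y<d       (suc x) = removeᶜ-∅ d (λ _ → refl) x
removeᶜ-singleᶜ-< (suc d) (suc y) M y<d       zero    = refl
removeᶜ-singleᶜ-< (suc d) (suc y) M (s≤s y<d) (suc x) = removeᶜ-singleᶜ-< d y M y<d x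

removeᶜ-singleᶜ-> : ∀ d y M → d ≤ y → removeᶜ d (singleᶜ (suc y) M) ≗ singleᶜ y M
removeᶜ-singleᶜ-> zero    y       M d≤y       x       = refl
removeᶜ-singleᶜ-> (suc d) (suc y) M d≤y       zero    = refl
removeᶜ-singleᶜ-> (suc d) (suc y) M (s≤s d≤y) (suc x) = removeᶜ-singleᶜ-> d y M d≤y x

removeᶜ-singleᶜ-here : ∀ d M → removeᶜ d (singleᶜ d M) ≗ ∅
removeᶜ-singleᶜ-here zero    M x       = refl
removeᶜ-singleᶜ-here (suc d) M zero    = refl
removeᶜ-singleᶜ-here (suc d) M (suc x) = removeᶜ-singleᶜ-here d M x

shiftᶜ : ℕ → Ctx → Ctx
shiftᶜ zero    Γ x       = Γ x
shiftᶜ (suc d) Γ zero    = []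
shiftᶜ (suc d) Γ (suc x) = shiftᶜ d Γ x

shiftᶜ-+ : ∀ d Γ Δ → shiftᶜ d (Γ +ᶜ Δ) ≗ (shiftᶜ d Γ +ᶜ shiftᶜ d Δ)
shiftᶜ-+ zero    Γ Δ x       = refl
shiftᶜ-+ (suc d) Γ Δ zero    = refl
shiftᶜ-+ (suc d) Γ Δ (suc x) = shiftᶜ-+ d Γ Δ x

shiftᶜ-∅ : ∀ d {Γ} → Γ ≗ ∅ → shiftᶜ d Γ ≗ ∅
shiftᶜ-∅ zero    Γ≗∅ x       = Γ≗∅ x
shiftᶜ-∅ (suc d) Γ≗∅ zero    = refl
shiftᶜ-∅ (suc d) Γ≗∅ (suc x) = shiftᶜ-∅ d Γ≗∅ x

shiftᶜ-cong : ∀ d {Γ Δ} → Γ ≈C Δ → shiftᶜ d Γ ≈C shiftᶜ d Δ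
shiftᶜ-cong zero    p x       = p x
shiftᶜ-cong (suc d) p zero    = []≈
shiftᶜ-cong (suc d) p (suc x) = shiftᶜ-cong d p x

ext-cong : ∀ {ρ ρ′} → ρ ≗ ρ′ → ext ρ ≗ ext ρ′
ext-cong e zero    = refl
ext-cong e (suc x) = cong suc (e x)

ren-cong : ∀ {ρ ρ′} → ρ ≗ ρ′ → ren ρ ≗ ren ρ′
ren-cong e (` x)     = cong `_ (e x)
ren-cong e (ƛ t)     = cong ƛ_ (ren-cong (ext-cong e) t)
ren-cong e (t · u)   = cong₂ _·_ (ren-cong e t) (ren-cong e u)
ren-cong e (t ⦅ u ⦆) = cong₂ _⦅_⦆ (ren-cong (ext-cong e) t) (ren-cong e u)

ext-∘ : ∀ ρ ρ′ → ext ρ ∘ ext ρ′ ≗ ext (ρ ∘ ρ′)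
ext-∘ ρ ρ′ zero    = refl
ext-∘ ρ ρ′ (suc x) = refl

ren-∘ : ∀ ρ ρ′ t → ren ρ (ren ρ′ t) ≡ ren (ρ ∘ ρ′) t
ren-∘ ρ ρ′ (` x)     = refl
ren-∘ ρ ρ′ (ƛ t)     = cong ƛ_ (trans (ren-∘ (ext ρ) (ext ρ′) t) (ren-cong (ext-∘ ρ ρ′) t))
ren-∘ ρ ρ′ (t · u)   = cong₂ _·_ (ren-∘ ρ ρ′ t) (ren-∘ ρ ρ′ u)
ren-∘ ρ ρ′ (t ⦅ u ⦆) =
  cong₂ _⦅_⦆ (trans (ren-∘ (ext ρ) (ext ρ′) t) (ren-cong (ext-∘ ρ ρ′) t)) (ren-∘ ρ ρ′ u)

ext-id : ext id ≗ id
ext-id zero    = refl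
ext-id (suc i) = refl

ren-id : ∀ t → ren id t ≡ t
ren-id (` x)     = refl
ren-id (ƛ t)     = cong ƛ_ (trans (ren-cong ext-id t) (ren-id t))
ren-id (t · u)   = cong₂ _·_ (ren-id t) (ren-id u)
ren-id (t ⦅ u ⦆) = cong₂ _⦅_⦆ (trans (ren-cong ext-id t) (ren-id t)) (ren-id u)

exts-cong : ∀ {σ σ′} → σ ≗ σ′ → exts σ ≗ exts σ′
exts-cong e zero    = refl
exts-cong e (suc x) = cong (ren suc) (e x)

sub-cong : ∀ {σ σ′} → σ ≗ σ′ → sub σ ≗ sub σ′
sub-cong e (` x)     = e x
sub-cong e (ƛ t)     = cong ƛ_ (sub-cong (exts-cong e) t)
sub-cong e (t · u)   = cong₂ _·_ (sub-cong e t) (sub-cong e u)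
sub-cong e (t ⦅ u ⦆) = cong₂ _⦅_⦆ (sub-cong (exts-cong e) t) (sub-cong e u)

exts-ext : ∀ σ ρ → exts σ ∘ ext ρ ≗ exts (σ ∘ ρ)
exts-ext σ ρ zero    = refl
exts-ext σ ρ (suc x) = refl

sub-ren : ∀ σ ρ t → sub σ (ren ρ t) ≡ sub (σ ∘ ρ) t
sub-ren σ ρ (` x)     = refl
sub-ren σ ρ (ƛ t)     = cong ƛ_ (trans (sub-ren (exts σ) (ext ρ) t) (sub-cong (exts-ext σ ρ) t))
sub-ren σ ρ (t · u)   = cong₂ _·_ (sub-ren σ ρ t) (sub-ren σ ρ u)
sub-ren σ ρ (t ⦅ u ⦆) =
  cong₂ _⦅_⦆ (trans (sub-ren (exts σ) (ext ρ) t) (sub-cong (exts-ext σ ρ) t)) (sub-ren σ ρ u)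

shift : ℕ → Term → Term
shift zero    v = v
shift (suc d) v = ren suc (shift d v)

ren-+-suc : ∀ k u → ren (λ i → suc (k +ℕ i)) u ≡ ren (k +ℕ_) (ren suc u)
ren-+-suc k u = sym (trans (ren-∘ (k +ℕ_) suc u) (ren-cong (ℕP.+-suc k) u))

svSub-suc : ∀ k v t → sub (svSub (suc k) v) t ≡ sub (svSub k v) (ren (punchIn 1) t)
svSub-suc k v t = sym (trans (sub-ren (svSub k v) (punchIn 1) t) (sub-cong svSub-punchIn t))
  where
  svSub-punchIn : svSub k v ∘ punchIn 1 ≗ svSub (suc k) v
  svSub-punchIn zero    = refl
  svSub-punchIn (suc i) = cong `_ (ℕP.+-suc k i)

subst-counters : ∀ {Γ m e s m′ e′ s′ t σ} → m ≡ m′ → e ≡ e′ → s ≡ s′ →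
                 Γ ⊢⟨ m , e , s ⟩ t ∶ σ → Γ ⊢⟨ m′ , e′ , s′ ⟩ t ∶ σ
subst-counters refl refl refl D = D

subst-term : ∀ {Γ m e s t t′ σ} → t ≡ t′ →
             Γ ⊢⟨ m , e , s ⟩ t ∶ σ → Γ ⊢⟨ m , e , s ⟩ t′ ∶ σ
subst-term refl D = D

conv-ctx : ∀ {Γ Γ′ m e s t σ} → Γ ≈C Γ′ →
           Γ ⊢⟨ m , e , s ⟩ t ∶ σ → Γ′ ⊢⟨ m , e , s ⟩ t ∶ σ
conv-ctx p D = conv D p ≈T-refl

conv-ty : ∀ {Γ m e s t σ σ′} → σ ≈T σ′ →
          Γ ⊢⟨ m , e , s ⟩ t ∶ σ → Γ ⊢⟨ m , e , s ⟩ t ∶ σ′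
conv-ty q D = conv D ≈C-refl q

-- The two ways to type u in t u or t[x\u] against the multitype M required by t:
-- persistently (appt-c, es-p) or consumingly (app-c, es-c).
data Arg (u : Term) (Δ : Ctx) (m e s : ℤ) (M : MType) : Set where
  arg-p : Δ ⊢⟨ m , e , s ⟩ u ∶ tt n → TightM M → Arg u Δ m e s M
  arg-c : Δ ⊢⟨ m , e , s ⟩ u ∶ mult M → Arg u Δ m e s M

Arg-resp-≈M : ∀ {u Δ m e s M N} → M ≈M N → Arg u Δ m e s M → Arg u Δ m e s N
Arg-resp-≈M p (arg-p D tM) = arg-p D (TightM-resp-≈M p tM)
Arg-resp-≈M p (arg-c D)    = arg-c (conv-ty (mult≈ p) D)

es-arg : ∀ {Γ Δ m e s m′ e′ s′ t u σ} →
         Γ ⊢⟨ m , e , s ⟩ t ∶ σ → Arg u Δ m′ e′ s′ (Γ 0) →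
         (unbind Γ +ᶜ Δ) ⊢⟨ m +ℤ m′ , e +ℤ e′ , s +ℤ s′ ⟩ t ⦅ u ⦆ ∶ σ
es-arg D (arg-p D′ tM) = es-p D D′ tM
es-arg D (arg-c D′)    = es-c D D′

app-arg : ∀ {Γ Δ m e s m′ e′ s′ t u M σ} →
          Γ ⊢⟨ m , e , s ⟩ t ∶ mult [ M ⇒ σ ] → Arg u Δ m′ e′ s′ M →
          (Γ +ᶜ Δ) ⊢⟨ m +ℤ m′ +ℤ + 1 , e +ℤ e′ -ℤ + 1 , s +ℤ s′ ⟩ t · u ∶ σ
app-arg D (arg-p D′ tM) = appt-c D D′ tM
app-arg D (arg-c D′)    = app-c D D′

abs-c-single : ∀ {Γ m e s t σ} → Γ ⊢⟨ m , e , s ⟩ t ∶ σ →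
               unbind Γ ⊢⟨ m , + 1 +ℤ e , s ⟩ ƛ t ∶ mult [ Γ 0 ⇒ σ ]
abs-c-single {Γ} {m} {e} {s} D =
  subst-counters (ℤP.+-identityʳ m) (cong (+ 1 +ℤ_) (ℤP.+-identityʳ e)) (ℤP.+-identityʳ s)
    (conv-ctx (+ᶜ-identityʳ (unbind Γ)) (abs-c (more D none)))

data ESView (t u : Term) (Γ : Ctx) : ℤ → ℤ → ℤ → Ty → Set where
  es-view : ∀ {Γ₁ Δ m₁ e₁ s₁ m₂ e₂ s₂ σ σ′} →
            Γ₁ ⊢⟨ m₁ , e₁ , s₁ ⟩ t ∶ σ′ → σ′ ≈T σ → Arg u Δ m₂ e₂ s₂ (Γ₁ 0) →
            (unbind Γ₁ +ᶜ Δ) ≈C Γ → ESView t u Γ (m₁ +ℤ m₂) (e₁ +ℤ e₂) (s₁ +ℤ s₂) σ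

es-inv : ∀ {t u Γ m e s σ} → Γ ⊢⟨ m , e , s ⟩ t ⦅ u ⦆ ∶ σ → ESView t u Γ m e s σ
es-inv (es-p D D′ tM) = es-view D ≈T-refl (arg-p D′ tM) ≈C-refl
es-inv (es-c D D′)    = es-view D ≈T-refl (arg-c D′) ≈C-refl
es-inv (conv D p q) with es-inv D
... | es-view D₁ q₁ A p₁ = es-view D₁ (≈T-trans q₁ q) A (≈C-trans p₁ p)

-- The rules var-p, val-p and var-c; M is what the context assigns to the variable.
data VarAxiom : MType → ℤ → ℤ → ℤ → Ty → Set where
  ax-var-p : VarAxiom [ tt vr ] (+ 0) (+ 0) (+ 0) (tt vr)
  ax-val-p : VarAxiom [] (+ 0) (+ 0) (+ 0) (tt vl)
  ax-var-c : ∀ {M} → VarAxiom M (+ 0) (+ 1) (+ 0) (mult M)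

var-axiom : ∀ {M m e s σ} → VarAxiom M m e s σ → ∀ y → singleᶜ y M ⊢⟨ m , e , s ⟩ ` y ∶ σ
var-axiom ax-var-p y = conv-ctx (≗⇒≈C (∶ᶜ≗singleᶜ y _)) var-p
var-axiom ax-val-p y = conv-ctx (≗∅⇒≈C (λ _ → refl) (singleᶜ-[] y)) val-p
var-axiom ax-var-c y = conv-ctx (≗⇒≈C (∶ᶜ≗singleᶜ y _)) var-c

VarAxiom-resp-≈T : ∀ {M m e s σ σ′} → VarAxiom M m e s σ → σ ≈T σ′ →
                   ∃[ M′ ] (VarAxiom M′ m e s σ′ × M ≈M M′)
VarAxiom-resp-≈T ax-var-p tt≈       = _ , ax-var-p , ≈M-refl
VarAxiom-resp-≈T ax-val-p tt≈       = _ , ax-val-p , ≈M-refl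
VarAxiom-resp-≈T ax-var-c (mult≈ p) = _ , ax-var-c , p

var-inv : ∀ {y Γ m e s σ} → Γ ⊢⟨ m , e , s ⟩ ` y ∶ σ →
          ∃[ M ] (VarAxiom M m e s σ × Γ ≈C singleᶜ y M)
var-inv {y} var-p = _ , ax-var-p , ≗⇒≈C (∶ᶜ≗singleᶜ y _)
var-inv {y} val-p = _ , ax-val-p , ≗∅⇒≈C (λ _ → refl) (singleᶜ-[] y)
var-inv {y} var-c = _ , ax-var-c , ≗⇒≈C (∶ᶜ≗singleᶜ y _)
var-inv {y} (conv D p q) with var-inv D
... | M , ax , r with VarAxiom-resp-≈T ax q
...   | M′ , ax′ , M≈M′ =
  M′ , ax′ , ≈C-trans (≈C-sym p) (≈C-trans r (singleᶜ-cong y M≈M′))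

data LamView (t : Term) (Γ : Ctx) : ℤ → ℤ → ℤ → Ty → Set where
  lam-p : Γ ≗ ∅ → LamView t Γ (+ 0) (+ 0) (+ 0) (tt vl)
  lam-c : ∀ {Γ′ m e s Ms N} → AbsPremises t Γ′ m e s Ms → Γ′ ≈C Γ → Ms ≈M N →
          LamView t Γ m (+ 1 +ℤ e) s (mult N)

lam-inv : ∀ {t Γ m e s σ} → Γ ⊢⟨ m , e , s ⟩ ƛ t ∶ σ → LamView t Γ m e s σ
lam-inv abs-p     = lam-p (λ _ → refl)
lam-inv (abs-c P) = lam-c P ≈C-refl ≈M-refl
lam-inv (conv D p q) with lam-inv D | q
... | lam-p Γ≗∅     | tt≈     = lam-p (λ x → ≈M-[]⁻¹ (subst (_≈M _) (Γ≗∅ x) (p x)))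
... | lam-c P r Ms≈ | mult≈ q′ = lam-c P (≈C-trans r p) (≈M-trans Ms≈ q′)

-- Strengthening

Strengthened : ℕ → Term → Ctx → ℤ → ℤ → ℤ → Ty → Set
Strengthened d t Γ m e s σ = ∃[ Γ′ ] (Γ′ ⊢⟨ m , e , s ⟩ t ∶ σ × Γ ≈C insertᶜ d Γ′)

Strengthened-conv : ∀ d {t Γ Γ′ m e s σ σ′} → Γ ≈C Γ′ → σ ≈T σ′ →
                    Strengthened d t Γ m e s σ → Strengthened d t Γ′ m e s σ′
Strengthened-conv d p q (Γ₀ , D , r) = Γ₀ , conv-ty q D , ≈C-trans (≈C-sym p) r

insertᶜ-+-≈C : ∀ d {Γ₁ Γ₂ A B} → Γ₁ ≈C insertᶜ d A → Γ₂ ≈C insertᶜ d B →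
               (Γ₁ +ᶜ Γ₂) ≈C insertᶜ d (A +ᶜ B)
insertᶜ-+-≈C d {A = A} {B} p q =
  ≈C-trans (+ᶜ-cong p q) (≗⇒≈C (λ x → sym (insertᶜ-+ d A B x)))

∅-≈C-insertᶜ : ∀ d {Γ} → Γ ≗ ∅ → Γ ≈C insertᶜ d ∅
∅-≈C-insertᶜ d Γ≗∅ = ≗∅⇒≈C Γ≗∅ (insertᶜ-∅ d (λ _ → refl))

mutual
  strengthen : ∀ d t {Γ m e s σ} → Γ ⊢⟨ m , e , s ⟩ ren (punchIn d) t ∶ σ →
               Strengthened d t Γ m e s σ
  strengthen d (` x) D with var-inv D
  ... | M , ax , r = singleᶜ x M , var-axiom ax x , ≈C-trans r (≗⇒≈C (insertᶜ-singleᶜ d x M))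
  strengthen d (ƛ t) abs-p        = ∅ , abs-p , ∅-≈C-insertᶜ d (λ _ → refl)
  strengthen d (ƛ t) (abs-c P) with strengthenᴾ d t P
  ... | Γ′ , Ms′ , P′ , q , p = Γ′ , conv-ty (mult≈ q) (abs-c P′) , p
  strengthen d (ƛ t) (conv D p q) = Strengthened-conv d p q (strengthen d (ƛ t) D)
  strengthen d (t · u) (app-p D₁ a D₂ b) with strengthen d t D₁ | strengthen d u D₂
  ... | A , D₁′ , p₁ | B , D₂′ , p₂ = A +ᶜ B , app-p D₁′ a D₂′ b , insertᶜ-+-≈C d p₁ p₂
  strengthen d (t · u) (app-c D₁ D₂) with strengthen d t D₁ | strengthen d u D₂
  ... | A , D₁′ , p₁ | B , D₂′ , p₂ = A +ᶜ B , app-c D₁′ D₂′ , insertᶜ-+-≈C d p₁ p₂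
  strengthen d (t · u) (appt-c D₁ D₂ tM) with strengthen d t D₁ | strengthen d u D₂
  ... | A , D₁′ , p₁ | B , D₂′ , p₂ = A +ᶜ B , appt-c D₁′ D₂′ tM , insertᶜ-+-≈C d p₁ p₂
  strengthen d (t · u) (conv D p q) = Strengthened-conv d p q (strengthen d (t · u) D)
  strengthen d (t ⦅ u ⦆) (es-p D₁ D₂ tM) with strengthen (suc d) t D₁ | strengthen d u D₂
  ... | A , D₁′ , p₁ | B , D₂′ , p₂ =
    unbind A +ᶜ B , es-p D₁′ D₂′ (TightM-resp-≈M (p₁ 0) tM) ,
    insertᶜ-+-≈C d (unbind-cong p₁) p₂
  strengthen d (t ⦅ u ⦆) (es-c D₁ D₂) with strengthen (suc d) t D₁ | strengthen d u D₂
  ... | A , D₁′ , p₁ | B , D₂′ , p₂ =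
    unbind A +ᶜ B , es-c D₁′ (conv-ty (mult≈ (p₁ 0)) D₂′) ,
    insertᶜ-+-≈C d (unbind-cong p₁) p₂
  strengthen d (t ⦅ u ⦆) (conv D p q) = Strengthened-conv d p q (strengthen d (t ⦅ u ⦆) D)

  strengthenᴾ : ∀ d t {Γ m e s Ms} → AbsPremises (ren (punchIn (suc d)) t) Γ m e s Ms →
                ∃[ Γ′ ] ∃[ Ms′ ]
                  (AbsPremises t Γ′ m e s Ms′ × Ms′ ≈M Ms × Γ ≈C insertᶜ d Γ′)
  strengthenᴾ d t none = ∅ , [] , none , []≈ , ∅-≈C-insertᶜ d (λ _ → refl)
  strengthenᴾ d t (more D P) with strengthen (suc d) t D | strengthenᴾ d t P
  ... | A , D′ , p | B , Ms′ , P′ , q , r =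
    unbind A +ᶜ B , _ , more D′ P′ , ≈M-∷ (⇒≈ (≈M-sym (p 0)) ≈T-refl) q ,
    insertᶜ-+-≈C d (unbind-cong p) r

unshift : ∀ d v {Γ m e s σ} → Γ ⊢⟨ m , e , s ⟩ shift d v ∶ σ →
          ∃[ B ] (B ⊢⟨ m , e , s ⟩ v ∶ σ × Γ ≈C shiftᶜ d B)
unshift zero    v D = _ , D , ≈C-refl
unshift (suc d) v D with strengthen 0 (shift d v) D
... | Γ′ , D′ , p with unshift d v D′
...   | B , D″ , q = B , D″ , ≈C-trans p (λ { zero → []≈ ; (suc x) → q x })

Arg-strengthen : ∀ {u B m e s M} → Arg (ren suc u) B m e s M →
                 ∃[ B′ ] (Arg u B′ m e s M × B ≈C insertᶜ 0 B′)
Arg-strengthen {u} (arg-p D tM) with strengthen 0 u D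
... | B′ , D′ , r = B′ , arg-p D′ tM , r
Arg-strengthen {u} (arg-c D) with strengthen 0 u D
... | B′ , D′ , r = B′ , arg-c D′ , r

[1+a]+[1+b]-1≡1+[a+b] : ∀ a b → (+ 1 +ℤ a) +ℤ (+ 1 +ℤ b) -ℤ + 1 ≡ + 1 +ℤ (a +ℤ b)
[1+a]+[1+b]-1≡1+[a+b] = solve-∀

[a+c+1]+[b+d]≡[a+b]+[c+d]+1 : ∀ a b c d →
  ((a +ℤ c) +ℤ + 1) +ℤ (b +ℤ d) ≡ ((a +ℤ b) +ℤ (c +ℤ d)) +ℤ + 1
[a+c+1]+[b+d]≡[a+b]+[c+d]+1 = solve-∀

[a+c]+[b+d-1]-1≡[a+b-1]+[c+d-1] : ∀ a b c d →
  ((a +ℤ c) +ℤ ((b +ℤ d) -ℤ + 1)) -ℤ + 1 ≡ ((a +ℤ b) -ℤ + 1) +ℤ ((c +ℤ d) -ℤ + 1)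
[a+c]+[b+d-1]-1≡[a+b-1]+[c+d-1] = solve-∀

[a+c-1]+[b+d-1]-1≡[a+b-1]+[c+d-1]-1 : ∀ a b c d →
  ((a +ℤ c) -ℤ + 1) +ℤ ((b +ℤ d) -ℤ + 1) -ℤ + 1 ≡
  ((a +ℤ b) -ℤ + 1) +ℤ ((c +ℤ d) -ℤ + 1) -ℤ + 1
[a+c-1]+[b+d-1]-1≡[a+b-1]+[c+d-1]-1 = solve-∀

[1+a+b]-1≡1+[a+b-1] : ∀ a b → ((+ 1 +ℤ a) +ℤ b) -ℤ + 1 ≡ + 1 +ℤ ((a +ℤ b) -ℤ + 1)
[1+a+b]-1≡1+[a+b-1] = solve-∀

[1+a+b]-1≡a+b : ∀ a b → ((+ 1 +ℤ a) +ℤ b) -ℤ + 1 ≡ a +ℤ b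
[1+a+b]-1≡a+b = solve-∀

[a+1]-1≡a : ∀ a → (a +ℤ + 1) -ℤ + 1 ≡ a
[a+1]-1≡a = solve-∀

[1+a]-1≡a : ∀ a → (+ 1 +ℤ a) -ℤ + 1 ≡ a
[1+a]-1≡a = solve-∀

-- As a -ℤ + 1 unfolds to a +ℤ (ℤ.- + 1), the k-lemmas also cover a final -1.
[a+[b+c]]+k≡[a+b+k]+c : ∀ a b c k → (a +ℤ (b +ℤ c)) +ℤ k ≡ ((a +ℤ b) +ℤ k) +ℤ c
[a+[b+c]]+k≡[a+b+k]+c = solve-∀

[a+c+b]+k≡[a+b+k]+c : ∀ a b c k → ((a +ℤ c) +ℤ b) +ℤ k ≡ ((a +ℤ b) +ℤ k) +ℤ c
[a+c+b]+k≡[a+b+k]+c = solve-∀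

a≡[a-1]+1 : ∀ a → a ≡ (a -ℤ + 1) +ℤ + 1
a≡[a-1]+1 = solve-∀

value-mult-[] : ∀ {v} → Value v → ∃[ Δ ] (Δ ≗ ∅ × Δ ⊢⟨ + 0 , + 1 , + 0 ⟩ v ∶ mult [])
value-mult-[] (v-var {y}) = _ , (λ x → trans (∶ᶜ≗singleᶜ y [] x) (singleᶜ-[] y x)) , var-c
value-mult-[] v-lam       = ∅ , (λ _ → refl) , abs-c none

AbsPremises-++ : ∀ {t Γ₁ Γ₂ m₁ e₁ s₁ m₂ e₂ s₂ Ms₁ Ms₂} →
                 AbsPremises t Γ₁ m₁ e₁ s₁ Ms₁ → AbsPremises t Γ₂ m₂ e₂ s₂ Ms₂ →
                 ∃[ Γ ] (AbsPremises t Γ (m₁ +ℤ m₂) (e₁ +ℤ e₂) (s₁ +ℤ s₂) (Ms₁ ++ Ms₂) ×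
                         Γ ≈C (Γ₁ +ᶜ Γ₂))
AbsPremises-++ {m₂ = m₂} {e₂} {s₂} none P₂
  rewrite ℤP.+-identityˡ m₂ | ℤP.+-identityˡ e₂ | ℤP.+-identityˡ s₂ = _ , P₂ , ≈C-refl
AbsPremises-++ {m₂ = m₂} {e₂} {s₂} (more {Γ = Γ} {Δ} {m} {e} {s} {m′} {e′} {s′} D P) P₂
  with AbsPremises-++ P P₂
... | Γ′ , P′ , p rewrite ℤP.+-assoc m m′ m₂ | ℤP.+-assoc e e′ e₂ | ℤP.+-assoc s s′ s₂ =
  _ , more D P′ , ≈C-trans (+ᶜ-congˡ (unbind Γ) p) (≈C-sym (+ᶜ-assoc (unbind Γ) Δ _))

-- The -1 is the e-unit of one of the two merged abs-c / var-c rules.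
value-mult-++ : ∀ {v B₁ B₂ m₁ e₁ s₁ m₂ e₂ s₂ M₁ M₂} → Value v →
                B₁ ⊢⟨ m₁ , e₁ , s₁ ⟩ v ∶ mult M₁ → B₂ ⊢⟨ m₂ , e₂ , s₂ ⟩ v ∶ mult M₂ →
                (B₁ +ᶜ B₂) ⊢⟨ m₁ +ℤ m₂ , e₁ +ℤ e₂ -ℤ + 1 , s₁ +ℤ s₂ ⟩ v ∶ mult (M₁ ++ M₂)
value-mult-++ (v-var {y}) D₁ D₂ with var-inv D₁ | var-inv D₂
... | M₁ , ax-var-c , r₁ | M₂ , ax-var-c , r₂ =
  conv-ctx (≈C-trans (≗⇒≈C (λ x → trans (∶ᶜ≗singleᶜ y _ x) (singleᶜ-++ y M₁ M₂ x)))
                     (≈C-sym (+ᶜ-cong r₁ r₂)))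
           var-c
value-mult-++ v-lam D₁ D₂ with lam-inv D₁ | lam-inv D₂
... | lam-c {e = e₁} P₁ r₁ q₁ | lam-c {e = e₂} P₂ r₂ q₂ with AbsPremises-++ P₁ P₂
...   | Γ , P , p =
  subst-counters refl (sym ([1+a]+[1+b]-1≡1+[a+b] e₁ e₂)) refl
    (conv (abs-c P) (≈C-trans p (+ᶜ-cong r₁ r₂)) (mult≈ (≈M-++ q₁ q₂)))

-- Anti-substitution

record SubstAt (d : ℕ) (v : Term) (σ : ℕ → Term) : Set where
  field
    at    : σ d ≡ shift d v
    below : ∀ {x} → x < d → σ x ≡ ` x
    above : ∀ {x} → d ≤ x → σ (suc x) ≡ ` x
open SubstAt

SubstAt-exts : ∀ {d v σ} → SubstAt d v σ → SubstAt (suc d) v (exts σ)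
SubstAt-exts S .at                      = cong (ren suc) (S .at)
SubstAt-exts S .below {zero}  x<d       = refl
SubstAt-exts S .below {suc x} (s≤s x<d) = cong (ren suc) (S .below x<d)
SubstAt-exts S .above {suc x} (s≤s d≤x) = cong (ren suc) (S .above d≤x)

SubstAt-svSub : ∀ v → SubstAt 0 v (svSub 0 v)
SubstAt-svSub v .at       = refl
SubstAt-svSub v .below ()
SubstAt-svSub v .above _  = refl

-- The -1 is the e-unit of the abs-c / var-c rule typing v, which leaves no trace in t{d:=v}.
data Unsubst (d : ℕ) (t v : Term) (Γ : Ctx) : ℤ → ℤ → ℤ → Ty → Set where
  unsubst : ∀ {A B mA eA sA mB eB sB τ} →
            A ⊢⟨ mA , eA , sA ⟩ t ∶ τ → B ⊢⟨ mB , eB , sB ⟩ v ∶ mult (A d) →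
            (removeᶜ d A +ᶜ shiftᶜ d B) ≈C Γ →
            Unsubst d t v Γ (mA +ℤ mB) (eA +ℤ eB -ℤ + 1) (sA +ℤ sB) τ

data Unsubstᴾ (d : ℕ) (t v : Term) (Γ : Ctx) : ℤ → ℤ → ℤ → MType → Set where
  unsubstᴾ : ∀ {A B mA eA sA mB eB sB Ms Ms′} →
             AbsPremises t A mA eA sA Ms′ → Ms′ ≈M Ms → B ⊢⟨ mB , eB , sB ⟩ v ∶ mult (A d) →
             (removeᶜ d A +ᶜ shiftᶜ d B) ≈C Γ →
             Unsubstᴾ d t v Γ (mA +ℤ mB) (eA +ℤ eB -ℤ + 1) (sA +ℤ sB) Ms

Unsubst-counters : ∀ {d t v Γ m e s m′ e′ s′ τ} → m ≡ m′ → e ≡ e′ → s ≡ s′ →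
                   Unsubst d t v Γ m e s τ → Unsubst d t v Γ m′ e′ s′ τ
Unsubst-counters refl refl refl U = U

Unsubstᴾ-counters : ∀ {d t v Γ m e s m′ e′ s′ Ms} → m ≡ m′ → e ≡ e′ → s ≡ s′ →
                    Unsubstᴾ d t v Γ m e s Ms → Unsubstᴾ d t v Γ m′ e′ s′ Ms
Unsubstᴾ-counters refl refl refl U = U

Unsubst-conv : ∀ {d t v Γ Γ′ m e s τ τ′} → Γ ≈C Γ′ → τ ≈T τ′ →
               Unsubst d t v Γ m e s τ → Unsubst d t v Γ′ m e s τ′
Unsubst-conv p q (unsubst D E r) = unsubst (conv-ty q D) E (≈C-trans r p)

split-ctx-+ : ∀ d A₁ A₂ B₁ B₂ {Γ₁ Γ₂} →
              (removeᶜ d A₁ +ᶜ shiftᶜ d B₁) ≈C Γ₁ → (removeᶜ d A₂ +ᶜ shiftᶜ d B₂) ≈C Γ₂ →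
              (removeᶜ d (A₁ +ᶜ A₂) +ᶜ shiftᶜ d (B₁ +ᶜ B₂)) ≈C (Γ₁ +ᶜ Γ₂)
split-ctx-+ d A₁ A₂ B₁ B₂ p q =
  ≈C-trans (≗⇒≈C (λ x → cong₂ _++_ (removeᶜ-+ d A₁ A₂ x) (shiftᶜ-+ d B₁ B₂ x)))
    (≈C-trans (+ᶜ-interchange (removeᶜ d A₁) (removeᶜ d A₂) (shiftᶜ d B₁) (shiftᶜ d B₂))
      (+ᶜ-cong p q))

split-ctx-∅ : ∀ d {Δ} → Δ ≗ ∅ → (removeᶜ d ∅ +ᶜ shiftᶜ d Δ) ≈C ∅
split-ctx-∅ d Δ≗∅ = ≗∅⇒≈C (λ x → cong₂ _++_ (removeᶜ-∅ d (λ _ → refl) x) (shiftᶜ-∅ d Δ≗∅ x)) (λ _ → refl)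

split-ctx-0 : ∀ {d A B Γ} → (removeᶜ (suc d) A +ᶜ shiftᶜ (suc d) B) ≈C Γ → A 0 ≈M Γ 0
split-ctx-0 {A = A} p = ≈M-trans (≡⇒≈M (sym (++-identityʳ (A 0)))) (p 0)

unsubst-app-p : ∀ {d t u v Γ₁ Γ₂ m₁ e₁ s₁ m₂ e₂ s₂ a b} → Value v →
                Unsubst d t v Γ₁ m₁ e₁ s₁ (tt a) → VrN a →
                Unsubst d u v Γ₂ m₂ e₂ s₂ (tt b) → VlN b →
                Unsubst d (t · u) v (Γ₁ +ᶜ Γ₂) (m₁ +ℤ m₂) (e₁ +ℤ e₂) (s₁ +ℤ s₂ +ℤ + 1) (tt n)
unsubst-app-p {d} V (unsubst {A₁} {B₁} {mA₁} {eA₁} {sA₁} {mB₁} {eB₁} {sB₁} D₁ E₁ p₁) a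
                    (unsubst {A₂} {B₂} {mA₂} {eA₂} {sA₂} {mB₂} {eB₂} {sB₂} D₂ E₂ p₂) b =
  Unsubst-counters (interchange mA₁ mA₂ mB₁ mB₂)
                   ([a+c]+[b+d-1]-1≡[a+b-1]+[c+d-1] eA₁ eB₁ eA₂ eB₂)
                   ([a+c+1]+[b+d]≡[a+b]+[c+d]+1 sA₁ sB₁ sA₂ sB₂)
    (unsubst (app-p D₁ a D₂ b) (value-mult-++ V E₁ E₂) (split-ctx-+ d A₁ A₂ B₁ B₂ p₁ p₂))

unsubst-app-c : ∀ {d t u v Γ₁ Γ₂ m₁ e₁ s₁ m₂ e₂ s₂ M τ} → Value v →
                Unsubst d t v Γ₁ m₁ e₁ s₁ (mult [ M ⇒ τ ]) →
                Unsubst d u v Γ₂ m₂ e₂ s₂ (mult M) →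
                Unsubst d (t · u) v (Γ₁ +ᶜ Γ₂) (m₁ +ℤ m₂ +ℤ + 1) (e₁ +ℤ e₂ -ℤ + 1) (s₁ +ℤ s₂) τ
unsubst-app-c {d} V (unsubst {A₁} {B₁} {mA₁} {eA₁} {sA₁} {mB₁} {eB₁} {sB₁} D₁ E₁ p₁)
                    (unsubst {A₂} {B₂} {mA₂} {eA₂} {sA₂} {mB₂} {eB₂} {sB₂} D₂ E₂ p₂) =
  Unsubst-counters ([a+c+1]+[b+d]≡[a+b]+[c+d]+1 mA₁ mB₁ mA₂ mB₂)
                   ([a+c-1]+[b+d-1]-1≡[a+b-1]+[c+d-1]-1 eA₁ eB₁ eA₂ eB₂)
                   (interchange sA₁ sA₂ sB₁ sB₂)
    (unsubst (app-c D₁ D₂) (value-mult-++ V E₁ E₂) (split-ctx-+ d A₁ A₂ B₁ B₂ p₁ p₂))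

unsubst-appt-c : ∀ {d t u v Γ₁ Γ₂ m₁ e₁ s₁ m₂ e₂ s₂ M τ} → Value v →
                 Unsubst d t v Γ₁ m₁ e₁ s₁ (mult [ M ⇒ τ ]) →
                 Unsubst d u v Γ₂ m₂ e₂ s₂ (tt n) → TightM M →
                 Unsubst d (t · u) v (Γ₁ +ᶜ Γ₂) (m₁ +ℤ m₂ +ℤ + 1) (e₁ +ℤ e₂ -ℤ + 1) (s₁ +ℤ s₂) τ
unsubst-appt-c {d} V (unsubst {A₁} {B₁} {mA₁} {eA₁} {sA₁} {mB₁} {eB₁} {sB₁} D₁ E₁ p₁)
                     (unsubst {A₂} {B₂} {mA₂} {eA₂} {sA₂} {mB₂} {eB₂} {sB₂} D₂ E₂ p₂) tM =
  Unsubst-counters ([a+c+1]+[b+d]≡[a+b]+[c+d]+1 mA₁ mB₁ mA₂ mB₂)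
                   ([a+c-1]+[b+d-1]-1≡[a+b-1]+[c+d-1]-1 eA₁ eB₁ eA₂ eB₂)
                   (interchange sA₁ sA₂ sB₁ sB₂)
    (unsubst (appt-c D₁ D₂ tM) (value-mult-++ V E₁ E₂) (split-ctx-+ d A₁ A₂ B₁ B₂ p₁ p₂))

unsubst-es-p : ∀ {d t u v Γ₁ Γ₂ m₁ e₁ s₁ m₂ e₂ s₂ τ} → Value v →
               Unsubst (suc d) t v Γ₁ m₁ e₁ s₁ τ →
               Unsubst d u v Γ₂ m₂ e₂ s₂ (tt n) → TightM (Γ₁ 0) →
               Unsubst d (t ⦅ u ⦆) v (unbind Γ₁ +ᶜ Γ₂) (m₁ +ℤ m₂) (e₁ +ℤ e₂) (s₁ +ℤ s₂) τ
unsubst-es-p {d} V (unsubst {A₁} {B₁} {mA₁} {eA₁} {sA₁} {mB₁} {eB₁} {sB₁} D₁ E₁ p₁)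
                   (unsubst {A₂} {B₂} {mA₂} {eA₂} {sA₂} {mB₂} {eB₂} {sB₂} D₂ E₂ p₂) tM =
  Unsubst-counters (interchange mA₁ mA₂ mB₁ mB₂)
                   ([a+c]+[b+d-1]-1≡[a+b-1]+[c+d-1] eA₁ eB₁ eA₂ eB₂)
                   (interchange sA₁ sA₂ sB₁ sB₂)
    (unsubst (es-p D₁ D₂ (TightM-resp-≈M (≈M-sym (split-ctx-0 {d} {A₁} {B₁} p₁)) tM))
             (value-mult-++ V E₁ E₂) (split-ctx-+ d (unbind A₁) A₂ B₁ B₂ (unbind-cong p₁) p₂))

unsubst-es-c : ∀ {d t u v Γ₁ Γ₂ m₁ e₁ s₁ m₂ e₂ s₂ τ} → Value v →
               Unsubst (suc d) t v Γ₁ m₁ e₁ s₁ τ →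
               Unsubst d u v Γ₂ m₂ e₂ s₂ (mult (Γ₁ 0)) →
               Unsubst d (t ⦅ u ⦆) v (unbind Γ₁ +ᶜ Γ₂) (m₁ +ℤ m₂) (e₁ +ℤ e₂) (s₁ +ℤ s₂) τ
unsubst-es-c {d} V (unsubst {A₁} {B₁} {mA₁} {eA₁} {sA₁} {mB₁} {eB₁} {sB₁} D₁ E₁ p₁)
                   (unsubst {A₂} {B₂} {mA₂} {eA₂} {sA₂} {mB₂} {eB₂} {sB₂} D₂ E₂ p₂) =
  Unsubst-counters (interchange mA₁ mA₂ mB₁ mB₂)
                   ([a+c]+[b+d-1]-1≡[a+b-1]+[c+d-1] eA₁ eB₁ eA₂ eB₂)
                   (interchange sA₁ sA₂ sB₁ sB₂)
    (unsubst (es-c D₁ (conv-ty (mult≈ (≈M-sym (split-ctx-0 {d} {A₁} {B₁} p₁))) D₂))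
             (value-mult-++ V E₁ E₂) (split-ctx-+ d (unbind A₁) A₂ B₁ B₂ (unbind-cong p₁) p₂))

unsubst-more : ∀ {d t v Γ₁ Γ₂ m₁ e₁ s₁ m₂ e₂ s₂ τ Ms} → Value v →
               Unsubst (suc d) t v Γ₁ m₁ e₁ s₁ τ → Unsubstᴾ d t v Γ₂ m₂ e₂ s₂ Ms →
               Unsubstᴾ d t v (unbind Γ₁ +ᶜ Γ₂) (m₁ +ℤ m₂) (e₁ +ℤ e₂) (s₁ +ℤ s₂)
                        ((Γ₁ 0 ⇒ τ) ∷ Ms)
unsubst-more {d} V (unsubst {A₁} {B₁} {mA₁} {eA₁} {sA₁} {mB₁} {eB₁} {sB₁} D₁ E₁ p₁)
                   (unsubstᴾ {A₂} {B₂} {mA₂} {eA₂} {sA₂} {mB₂} {eB₂} {sB₂} P q E₂ p₂) =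
  Unsubstᴾ-counters (interchange mA₁ mA₂ mB₁ mB₂)
                    ([a+c]+[b+d-1]-1≡[a+b-1]+[c+d-1] eA₁ eB₁ eA₂ eB₂)
                    (interchange sA₁ sA₂ sB₁ sB₂)
    (unsubstᴾ (more D₁ P) (≈M-∷ (⇒≈ (split-ctx-0 {d} {A₁} {B₁} p₁) ≈T-refl) q)
              (value-mult-++ V E₁ E₂) (split-ctx-+ d (unbind A₁) A₂ B₁ B₂ (unbind-cong p₁) p₂))

unsubst-abs : ∀ {d t v Γ m e s Ms} → Unsubstᴾ d t v Γ m e s Ms →
              Unsubst d (ƛ t) v Γ m (+ 1 +ℤ e) s (mult Ms)
unsubst-abs (unsubstᴾ {eA = eA} {eB = eB} P q E p) =
  Unsubst-counters refl ([1+a+b]-1≡1+[a+b-1] eA eB) refl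
    (unsubst (conv-ty (mult≈ q) (abs-c P)) E p)

unsubst-var-≢ : ∀ {d y v Γ M m e s τ} → Value v → VarAxiom M m e s τ → y ≢ d →
                removeᶜ d (singleᶜ y M) ≈C Γ → Unsubst d (` y) v Γ m e s τ
unsubst-var-≢ {d} {y} {M = M} V ax y≢d p with value-mult-[] V
... | Δ , Δ≗∅ , E =
  Unsubst-counters (ℤP.+-identityʳ _) ([a+1]-1≡a _) (ℤP.+-identityʳ _)
    (unsubst (var-axiom ax y) (conv-ty (mult≈ (≡⇒≈M (sym (singleᶜ-there y M d y≢d)))) E)
      (≈C-trans (+ᶜ-congˡ _ (≗⇒≈C (shiftᶜ-∅ d Δ≗∅))) (≈C-trans (+ᶜ-identityʳ _) p)))

unsubst-var-vl : ∀ {d v Γ B₀} → Value v → B₀ ≗ ∅ → Γ ≈C shiftᶜ d B₀ →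
                 Unsubst d (` d) v Γ (+ 0) (+ 0) (+ 0) (tt vl)
unsubst-var-vl {d} V B₀≗∅ p with value-mult-[] V
... | Δ , Δ≗∅ , E =
  unsubst (var-axiom ax-val-p d) (conv-ty (mult≈ (≡⇒≈M (sym (singleᶜ-here d [])))) E)
    (≈C-trans (≗∅⇒≈C (λ x → cong₂ _++_ (removeᶜ-singleᶜ-here d [] x) (shiftᶜ-∅ d Δ≗∅ x))
                      (shiftᶜ-∅ d B₀≗∅))
              (≈C-sym p))

unsubst-var-mult : ∀ {d v Γ B₀ m e s M} → B₀ ⊢⟨ m , e , s ⟩ v ∶ mult M →
                   Γ ≈C shiftᶜ d B₀ → Unsubst d (` d) v Γ m e s (mult M)
unsubst-var-mult {d} {M = M} D₀ p =
  Unsubst-counters (ℤP.+-identityˡ _) ([1+a]-1≡a _) (ℤP.+-identityˡ _)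
    (unsubst (var-axiom ax-var-c d) (conv-ty (mult≈ (≡⇒≈M (sym (singleᶜ-here d M)))) D₀)
      (≈C-trans (+ᶜ-congʳ _ (≗⇒≈C (removeᶜ-singleᶜ-here d M))) (≈C-sym p)))

unsubst-var-vr : ∀ {d y Γ B₀} → B₀ ≈C singleᶜ y [ tt vr ] → Γ ≈C shiftᶜ d B₀ →
                 Unsubst d (` d) (` y) Γ (+ 0) (+ 0) (+ 0) (tt vr)
unsubst-var-vr {d} {y} r p =
  unsubst (var-axiom ax-var-p d)
    (conv-ty (mult≈ (≡⇒≈M (sym (singleᶜ-here d _)))) (var-axiom ax-var-c y))
    (≈C-trans (+ᶜ-congʳ _ (≗⇒≈C (removeᶜ-singleᶜ-here d _)))
              (≈C-trans (shiftᶜ-cong d (≈C-sym r)) (≈C-sym p)))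

unsubst-var-here : ∀ {d v Γ B₀ m e s τ} → Value v → B₀ ⊢⟨ m , e , s ⟩ v ∶ τ →
                   Γ ≈C shiftᶜ d B₀ → Unsubst d (` d) v Γ m e s τ
unsubst-var-here (v-var {y}) D₀ p with var-inv D₀
... | _ , ax-var-p , r = unsubst-var-vr r p
... | _ , ax-val-p , r = unsubst-var-vl v-var (≈C-resp-≗∅ r (singleᶜ-[] y)) p
... | _ , ax-var-c , r = unsubst-var-mult D₀ p
unsubst-var-here v-lam D₀ p with lam-inv D₀
... | lam-p B₀≗∅  = unsubst-var-vl v-lam B₀≗∅ p
... | lam-c _ _ _ = unsubst-var-mult D₀ p

mutual
  unsubst-term : ∀ d t {σ v Γ m e s τ} → Value v → SubstAt d v σ →
                 Γ ⊢⟨ m , e , s ⟩ sub σ t ∶ τ → Unsubst d t v Γ m e s τ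
  unsubst-term d (` x) V S D with ℕP.<-cmp x d
  ... | tri< x<d _ _ with var-inv (subst-term (S .below x<d) D)
  ...   | M , ax , r =
    unsubst-var-≢ V ax (ℕP.<⇒≢ x<d)
      (≈C-trans (≗⇒≈C (removeᶜ-singleᶜ-< d x M x<d)) (≈C-sym r))
  unsubst-term d (` x) V S D | tri≈ _ refl _ with unshift d _ (subst-term (S .at) D)
  ... | B₀ , D₀ , p = unsubst-var-here V D₀ p
  unsubst-term d (` suc x) V S D | tri> _ _ (s≤s d≤x)
    with var-inv (subst-term (S .above d≤x) D)
  ... | M , ax , r =
    unsubst-var-≢ V ax (ℕP.>⇒≢ (s≤s d≤x))
      (≈C-trans (≗⇒≈C (removeᶜ-singleᶜ-> d x M d≤x)) (≈C-sym r))
  unsubst-term d (ƛ t) V S abs-p with value-mult-[] V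
  ... | Δ , Δ≗∅ , E = unsubst abs-p E (split-ctx-∅ d Δ≗∅)
  unsubst-term d (ƛ t) V S (abs-c P) = unsubst-abs (unsubst-premises d t V (SubstAt-exts S) P)
  unsubst-term d (ƛ t) V S (conv D p q) = Unsubst-conv p q (unsubst-term d (ƛ t) V S D)
  unsubst-term d (t · u) V S (app-p D₁ a D₂ b) =
    unsubst-app-p V (unsubst-term d t V S D₁) a (unsubst-term d u V S D₂) b
  unsubst-term d (t · u) V S (app-c D₁ D₂) =
    unsubst-app-c V (unsubst-term d t V S D₁) (unsubst-term d u V S D₂)
  unsubst-term d (t · u) V S (appt-c D₁ D₂ tM) =
    unsubst-appt-c V (unsubst-term d t V S D₁) (unsubst-term d u V S D₂) tM
  unsubst-term d (t · u) V S (conv D p q) = Unsubst-conv p q (unsubst-term d (t · u) V S D)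
  unsubst-term d (t ⦅ u ⦆) V S (es-p D₁ D₂ tM) =
    unsubst-es-p V (unsubst-term (suc d) t V (SubstAt-exts S) D₁) (unsubst-term d u V S D₂) tM
  unsubst-term d (t ⦅ u ⦆) V S (es-c D₁ D₂) =
    unsubst-es-c V (unsubst-term (suc d) t V (SubstAt-exts S) D₁) (unsubst-term d u V S D₂)
  unsubst-term d (t ⦅ u ⦆) V S (conv D p q) =
    Unsubst-conv p q (unsubst-term d (t ⦅ u ⦆) V S D)

  unsubst-premises : ∀ d t {σ v Γ m e s Ms} → Value v → SubstAt (suc d) v σ →
                     AbsPremises (sub σ t) Γ m e s Ms → Unsubstᴾ d t v Γ m e s Ms
  unsubst-premises d t V S none with value-mult-[] V
  ... | Δ , Δ≗∅ , E = unsubstᴾ none []≈ E (split-ctx-∅ d Δ≗∅)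
  unsubst-premises d t V S (more D P) =
    unsubst-more V (unsubst-term (suc d) t V S D) (unsubst-premises d t V S P)

data SvSplit (L : LCtx) (t v : Term) (Γ : Ctx) : ℤ → ℤ → ℤ → Ty → Set where
  svSplit : ∀ {A B mA eA sA mB eB sB σ} →
            A ⊢⟨ mA , eA , sA ⟩ t ∶ σ → B ⊢⟨ mB , eB , sB ⟩ plug L v ∶ mult (A 0) →
            (unbind A +ᶜ B) ≈C Γ → SvSplit L t v Γ (mA +ℤ mB) (eA +ℤ eB -ℤ + 1) (sA +ℤ sB) σ

SvSplit-counters : ∀ {L t v Γ m e s m′ e′ s′ σ} → m ≡ m′ → e ≡ e′ → s ≡ s′ →
                   SvSplit L t v Γ m e s σ → SvSplit L t v Γ m′ e′ s′ σ
SvSplit-counters refl refl refl S = S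

-- Peeling off the outermost substitution [y\w] of L puts y at index 1 of t, which
-- t does not mention; strengthening removes it again.
sv-split : ∀ L t {v Γ m e s σ} → Value v →
           Γ ⊢⟨ m , e , s ⟩ plug L (sub (svSub (depth L) v) t) ∶ σ →
           SvSplit L t v Γ m e s σ
sv-split □ t {v} V D with unsubst-term 0 t V (SubstAt-svSub v) D
... | unsubst DA EB p = svSplit DA EB p
sv-split (L ⟦ w ⟧) t {v} {Γ} V D
  with es-inv (subst-term (cong (λ X → plug L X ⦅ w ⦆) (svSub-suc (depth L) v t)) D)
... | es-view {Γ₁} {Δ} {m₂ = m₂} {e₂ = e₂} {s₂ = s₂} D₁ q arg p
  with sv-split L (ren (punchIn 1) t) V D₁
...   | svSplit {A} {B} {mA} {eA} {sA} {mB} {eB} {sB} DA EB pA with strengthen 1 t DA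
...     | A′ , DA′ , r =
  SvSplit-counters (sym (ℤP.+-assoc mA mB m₂))
                   ([a+[b+c]]+k≡[a+b+k]+c eA eB e₂ (ℤ.- + 1))
                   (sym (ℤP.+-assoc sA sB s₂))
    (svSplit (conv-ty q DA′) (conv-ty (mult≈ (r 0)) (es-arg EB (Arg-resp-≈M arg-ctx arg)))
             ctx)
  where
  arg-ctx : Γ₁ 0 ≈M B 0
  arg-ctx = ≈M-trans (≈M-sym (pA 0)) (≈M-++ʳ (B 0) (r 1))
  ctx : (unbind A′ +ᶜ (unbind B +ᶜ Δ)) ≈C Γ
  ctx = ≈C-trans (≈C-sym (+ᶜ-assoc (unbind A′) (unbind B) Δ))
          (≈C-trans (+ᶜ-congʳ Δ (+ᶜ-congʳ (unbind B) (λ x → ≈M-sym (r (suc (suc x))))))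
            (≈C-trans (+ᶜ-congʳ Δ (unbind-cong pA)) p))

data DbSplit (L : LCtx) (t u : Term) (Γ : Ctx) : ℤ → ℤ → ℤ → Ty → Set where
  dbSplit : ∀ {A B mA eA sA mB eB sB M σ} →
            A ⊢⟨ mA , eA , sA ⟩ plug L (ƛ t) ∶ mult [ M ⇒ σ ] → Arg u B mB eB sB M →
            (A +ᶜ B) ≈C Γ → DbSplit L t u Γ (mA +ℤ mB) (eA +ℤ eB -ℤ + 1) (sA +ℤ sB) σ

DbSplit-counters : ∀ {L t u Γ m e s m′ e′ s′ σ} → m ≡ m′ → e ≡ e′ → s ≡ s′ →
                   DbSplit L t u Γ m e s σ → DbSplit L t u Γ m′ e′ s′ σ
DbSplit-counters refl refl refl S = S

dB-split : ∀ L t u {Γ m e s σ} →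
           Γ ⊢⟨ m , e , s ⟩ plug L (t ⦅ ren (depth L +ℕ_) u ⦆) ∶ σ → DbSplit L t u Γ m e s σ
dB-split □ t u D with es-inv (subst-term (cong (t ⦅_⦆) (ren-id u)) D)
... | es-view {m₁ = m₁} {e₁} {s₁} {m₂} {e₂} {s₂} D₁ q arg p =
  DbSplit-counters refl ([1+a+b]-1≡a+b e₁ e₂) refl
    (dbSplit (abs-c-single (conv-ty q D₁)) arg p)
dB-split (L ⟦ w ⟧) t u {Γ} D
  with es-inv (subst-term (cong (λ X → plug L (t ⦅ X ⦆) ⦅ w ⦆) (ren-+-suc (depth L) u)) D)
... | es-view {Γ₁} {Δ} {m₂ = m₂} {e₂ = e₂} {s₂ = s₂} D₁ q arg p
  with dB-split L t (ren suc u) D₁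
...   | dbSplit {A} {B} {mA} {eA} {sA} {mB} {eB} {sB} DA argB pAB with Arg-strengthen argB
...     | B′ , argB′ , r =
  DbSplit-counters (xy∙z≈xz∙y mA m₂ mB)
                   ([a+c+b]+k≡[a+b+k]+c eA eB e₂ (ℤ.- + 1))
                   (xy∙z≈xz∙y sA s₂ sB)
    (dbSplit (conv-ty (mult≈ (≈M-∷ (⇒≈ ≈M-refl q) []≈)) (es-arg DA (Arg-resp-≈M arg-ctx arg)))
             argB′ ctx)
  where
  arg-ctx : Γ₁ 0 ≈M A 0
  arg-ctx = ≈M-trans (≈M-sym (pAB 0))
              (≈M-trans (≈M-++ˡ (A 0) (r 0)) (≡⇒≈M (++-identityʳ (A 0))))
  ctx : ((unbind A +ᶜ Δ) +ᶜ B′) ≈C Γ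
  ctx = ≈C-trans (+ᶜ-swapʳ (unbind A) Δ B′)
          (≈C-trans (+ᶜ-congʳ Δ (+ᶜ-congˡ (unbind A) (λ x → ≈M-sym (r (suc x)))))
            (≈C-trans (+ᶜ-congʳ Δ (unbind-cong pAB)) p))

-- Subject expansion

δm δe : Kind → ℤ
δm mul  = + 1
δm expo = + 0
δe mul  = + 0
δe expo = + 1

expand-root : ∀ {t t′ k Γ m e s σ} → t ↦[ k ] t′ → Γ ⊢⟨ m , e , s ⟩ t′ ∶ σ →
              Γ ⊢⟨ m +ℤ δm k , e +ℤ δe k , s ⟩ t ∶ σ
expand-root (dB L t u) D with dB-split L t u D
... | dbSplit DA arg p =
  subst-counters refl (sym (ℤP.+-identityʳ _)) refl (conv-ctx p (app-arg DA arg))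
expand-root (sv L t v V) D with sv-split L t V D
... | svSplit DA EB p =
  subst-counters (sym (ℤP.+-identityʳ _)) (a≡[a-1]+1 _) refl (conv-ctx p (es-c DA EB))

expand : ∀ {t t′ k Γ m e s σ} → t →v[ k ] t′ → Γ ⊢⟨ m , e , s ⟩ t′ ∶ σ →
         Γ ⊢⟨ m +ℤ δm k , e +ℤ δe k , s ⟩ t ∶ σ
expand (root ρ) D = expand-root ρ D
expand st (conv D p q) = conv (expand st D) p q
expand {k = k} (appL st) (app-p {m = m₁} {e₁} {m' = m₂} {e₂} D₁ a D₂ b) =
  subst-counters (xy∙z≈xz∙y m₁ (δm k) m₂) (xy∙z≈xz∙y e₁ (δe k) e₂) refl
    (app-p (expand st D₁) a D₂ b)
expand {k = k} (appL st) (app-c {m = m₁} {e₁} {m' = m₂} {e₂} D₁ D₂) =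
  subst-counters ([a+c+b]+k≡[a+b+k]+c m₁ m₂ (δm k) (+ 1))
                 ([a+c+b]+k≡[a+b+k]+c e₁ e₂ (δe k) (ℤ.- + 1)) refl
    (app-c (expand st D₁) D₂)
expand {k = k} (appL st) (appt-c {m = m₁} {e₁} {m' = m₂} {e₂} D₁ D₂ tM) =
  subst-counters ([a+c+b]+k≡[a+b+k]+c m₁ m₂ (δm k) (+ 1))
                 ([a+c+b]+k≡[a+b+k]+c e₁ e₂ (δe k) (ℤ.- + 1)) refl
    (appt-c (expand st D₁) D₂ tM)
expand {k = k} (appR st) (app-p {m = m₁} {e₁} {m' = m₂} {e₂} D₁ a D₂ b) =
  subst-counters (sym (ℤP.+-assoc m₁ m₂ (δm k))) (sym (ℤP.+-assoc e₁ e₂ (δe k))) refl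
    (app-p D₁ a (expand st D₂) b)
expand {k = k} (appR st) (app-c {m = m₁} {e₁} {m' = m₂} {e₂} D₁ D₂) =
  subst-counters ([a+[b+c]]+k≡[a+b+k]+c m₁ m₂ (δm k) (+ 1))
                 ([a+[b+c]]+k≡[a+b+k]+c e₁ e₂ (δe k) (ℤ.- + 1)) refl
    (app-c D₁ (expand st D₂))
expand {k = k} (appR st) (appt-c {m = m₁} {e₁} {m' = m₂} {e₂} D₁ D₂ tM) =
  subst-counters ([a+[b+c]]+k≡[a+b+k]+c m₁ m₂ (δm k) (+ 1))
                 ([a+[b+c]]+k≡[a+b+k]+c e₁ e₂ (δe k) (ℤ.- + 1)) refl
    (appt-c D₁ (expand st D₂) tM)
expand {k = k} (esL st) (es-p {m = m₁} {e₁} {m' = m₂} {e₂} D₁ D₂ tM) =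
  subst-counters (xy∙z≈xz∙y m₁ (δm k) m₂) (xy∙z≈xz∙y e₁ (δe k) e₂) refl
    (es-p (expand st D₁) D₂ tM)
expand {k = k} (esL st) (es-c {m = m₁} {e₁} {m' = m₂} {e₂} D₁ D₂) =
  subst-counters (xy∙z≈xz∙y m₁ (δm k) m₂) (xy∙z≈xz∙y e₁ (δe k) e₂) refl
    (es-c (expand st D₁) D₂)
expand {k = k} (esR st) (es-p {m = m₁} {e₁} {m' = m₂} {e₂} D₁ D₂ tM) =
  subst-counters (sym (ℤP.+-assoc m₁ m₂ (δm k))) (sym (ℤP.+-assoc e₁ e₂ (δe k))) refl
    (es-p D₁ (expand st D₂) tM)
expand {k = k} (esR st) (es-c {m = m₁} {e₁} {m' = m₂} {e₂} D₁ D₂) =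
  subst-counters (sym (ℤP.+-assoc m₁ m₂ (δm k))) (sym (ℤP.+-assoc e₁ e₂ (δe k))) refl
    (es-c D₁ (expand st D₂))

expand-mul : ∀ {t t′ Γ m e s σ} → t →v[ mul ] t′ → Γ ⊢⟨ + m , + e , s ⟩ t′ ∶ σ →
             Γ ⊢⟨ + suc m , + e , s ⟩ t ∶ σ
expand-mul {m = m} {e} st D =
  subst-counters (cong +_ (ℕP.+-comm m 1)) (cong +_ (ℕP.+-identityʳ e)) refl (expand st D)

expand-expo : ∀ {t t′ Γ m e s σ} → t →v[ expo ] t′ → Γ ⊢⟨ + m , + e , s ⟩ t′ ∶ σ →
              Γ ⊢⟨ + m , + suc e , s ⟩ t ∶ σ
expand-expo {m = m} {e} st D =
  subst-counters (cong +_ (ℕP.+-identityʳ m)) (cong +_ (ℕP.+-comm e 1)) refl (expand st D)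

-- Tight typings of normal forms

FiniteSupport-∅ : FiniteSupport ∅
FiniteSupport-∅ = 0 , λ _ _ → refl

FiniteSupport-∶ᶜ : ∀ y M → FiniteSupport (y ∶ᶜ M)
FiniteSupport-∶ᶜ y M =
  suc y , λ x y<x → trans (∶ᶜ≗singleᶜ y M x) (singleᶜ-there y M x (ℕP.<⇒≢ y<x))

FiniteSupport-+ : ∀ {Γ Δ} → FiniteSupport Γ → FiniteSupport Δ → FiniteSupport (Γ +ᶜ Δ)
FiniteSupport-+ (N₁ , f₁) (N₂ , f₂) = N₁ +ℕ N₂ , λ x N≤x →
  cong₂ _++_ (f₁ x (ℕP.≤-trans (ℕP.m≤m+n N₁ N₂) N≤x)) (f₂ x (ℕP.≤-trans (ℕP.m≤n+m N₂ N₁) N≤x))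
FiniteSupport-unbind : ∀ {Γ} → FiniteSupport Γ → FiniteSupport (unbind Γ)
FiniteSupport-unbind (N , f) = N , λ x N≤x → f (suc x) (ℕP.m≤n⇒m≤1+n N≤x)

TightCtx-∅ : TightCtx ∅
TightCtx-∅ _ = []

TightCtx-∶ᶜ : ∀ y {M} → TightM M → TightCtx (y ∶ᶜ M)
TightCtx-∶ᶜ y {M} tM x = subst TightM (sym (∶ᶜ≗singleᶜ y M x)) (tight-singleᶜ y x)
  where
  tight-singleᶜ : ∀ y x → TightM (singleᶜ y M x)
  tight-singleᶜ zero    zero    = tM
  tight-singleᶜ zero    (suc x) = []
  tight-singleᶜ (suc y) zero    = []
  tight-singleᶜ (suc y) (suc x) = tight-singleᶜ y x

TightCtx-+ : ∀ {Γ Δ} → TightCtx Γ → TightCtx Δ → TightCtx (Γ +ᶜ Δ)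
TightCtx-+ tΓ tΔ x = ++⁺ (tΓ x) (tΔ x)

TightlyTyped : Term → TT → Set
TightlyTyped p a =
  ∃[ Γ ] (FiniteSupport Γ × TightCtx Γ × Γ ⊢⟨ + 0 , + 0 , + size p ⟩ p ∶ tt a)

tightly-typed-app : ∀ {t u a b} → TightlyTyped t a → VrN a → TightlyTyped u b → VlN b →
                    TightlyTyped (t · u) n
tightly-typed-app (Γ , fΓ , tΓ , D) a (Δ , fΔ , tΔ , D′) b =
  Γ +ᶜ Δ , FiniteSupport-+ fΓ fΔ , TightCtx-+ tΓ tΔ , app-p D a D′ b

tightly-typed-es : ∀ {t u a} → TightlyTyped t a → TightlyTyped u n → TightlyTyped (t ⦅ u ⦆) a
tightly-typed-es (Γ , fΓ , tΓ , D) (Δ , fΔ , tΔ , D′) =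
  unbind Γ +ᶜ Δ , FiniteSupport-+ (FiniteSupport-unbind fΓ) fΔ ,
  TightCtx-+ (λ x → tΓ (suc x)) tΔ , es-p D D′ (tΓ 0)

mutual
  vr-tightly-typed : ∀ {p} → Vr p → TightlyTyped p vr
  vr-tightly-typed (vr-var {x}) =
    _ , FiniteSupport-∶ᶜ x _ , TightCtx-∶ᶜ x ((vr , refl) ∷ []) , var-p
  vr-tightly-typed (vr-es t u) = tightly-typed-es (vr-tightly-typed t) (ne-tightly-typed u)

  vr-tightly-typed-vl : ∀ {p} → Vr p → TightlyTyped p vl
  vr-tightly-typed-vl vr-var      = ∅ , FiniteSupport-∅ , TightCtx-∅ , val-p
  vr-tightly-typed-vl (vr-es t u) = tightly-typed-es (vr-tightly-typed-vl t) (ne-tightly-typed u)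

  ne-tightly-typed : ∀ {p} → Ne p → TightlyTyped p n
  ne-tightly-typed (ne-vr t u) with no-tightly-typed u
  ... | _ , b , U = tightly-typed-app (vr-tightly-typed t) vrN-vr U b
  ne-tightly-typed (ne-ne t u) with no-tightly-typed u
  ... | _ , b , U = tightly-typed-app (ne-tightly-typed t) vrN-n U b
  ne-tightly-typed (ne-es t u) = tightly-typed-es (ne-tightly-typed t) (ne-tightly-typed u)

  no-tightly-typed : ∀ {p} → No p → ∃[ a ] (VlN a × TightlyTyped p a)
  no-tightly-typed no-lam      = vl , vlN-vl , ∅ , FiniteSupport-∅ , TightCtx-∅ , abs-p
  no-tightly-typed (no-vr t)   = vl , vlN-vl , vr-tightly-typed-vl t
  no-tightly-typed (no-ne t)   = n , vlN-n , ne-tightly-typed t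
  no-tightly-typed (no-es t u) with no-tightly-typed t
  ... | a , b , T = a , b , tightly-typed-es T (ne-tightly-typed u)

theorem4p13 : ∀ {t p : Term} {m e : ℕ} →
              t →v⟨ m , e ⟩ p → No p →
              ∃[ Γ ] ∃[ σ ] (FiniteSupport Γ × TightCtx Γ × IsTight σ ×
                (Γ ⊢⟨ + m , + e , + size p ⟩ t ∶ σ))
theorem4p13 done nf with no-tightly-typed nf
... | a , _ , Γ , fΓ , tΓ , D = Γ , tt a , fΓ , tΓ , (a , refl) , D
theorem4p13 (stepm st rest) nf with theorem4p13 rest nf
... | Γ , σ , fΓ , tΓ , tσ , D = Γ , σ , fΓ , tΓ , tσ , expand-mul st D
theorem4p13 (stepe st rest) nf with theorem4p13 rest nf
... | Γ , σ , fΓ , tΓ , tσ , D = Γ , σ , fΓ , tΓ , tσ , expand-expo st D
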